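{- Let $S$ be a scheduling problem on $n$ items such that the set of ordered set partitions solving $S$ is closed under directed refinement (if $\Phi$ solves $S$ and $\Phi\preceq\Psi$, then $\Psi$ solves $S$). Suppose that for every ordered set partition $\Phi$ solving $S$ there exists a unique coarsest ordered set partition $\Phi_c$ solving $S$ with $\Phi_c\preceq\Phi$. Then $\mathrm{Allow}(S)$ is partitionable; hence the coefficients of $\mathcal{S}_S$ in the nc-fundamental basis and the $h^*$-vector of $\chi_S$ are non-negative.
   Context: Let $\mathbb{N}=\{1,2,\dots\}$. A scheduling problem on $n$ items is a boolean formula $S$ in $x_1,\dots,x_n$ built from atomic formulas $x_i\le x_j$; $\chi_S(k)$ is the number of $a\in[k]^n$ at which $S$ is true. Ordered set partitions $\Phi=(\Phi_1|\cdots|\Phi_\ell)$ of $[n]$ (nonempty disjoint blocks covering $[n]$, length $\ell(\Phi)$); for $a\in\mathbb{R}^n$, $\Delta(a)$ is the ordered set partition with $a$ constant on blocks and strictly increasing from block to block; $\Phi$ solves $S$ if $S$ holds at points $a$ with $\Delta(a)=\Phi$. $\Psi$ refines $\Phi$ if each block of $\Phi$ is a union of consecutive blocks of $\Psi$. Directed refinement $\preceq$ is the partial order generated by the covering relations $(\Phi_1,\dots,\Phi_{i-1},\Phi_i\cup\Phi_{i+1},\Phi_{i+2},\dots,\Phi_k)\lessdot(\Phi_1,\dots,\Phi_k)$ whenever every element of $\Phi_i$ is less than every element of $\Phi_{i+1}$. $\sigma_\Phi=\{x\in(0,1)^n:\Delta(x)=\Phi\}$ is a relatively open simplex of dimension $\ell(\Phi)$;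 these triangulate $(0,1)^n$, with $\sigma_\Phi\subseteq\overline{\sigma_\Psi}$ iff $\Psi$ refines $\Phi$. $\mathrm{Allow}(S)=\{\sigma_\Phi:\Phi\text{ solves }S\}$; it is partitionable if the set of $\Phi$ solving $S$ can be partitioned into intervals $[\Phi_c,\Phi_f]$ of the refinement order with $\ell(\Phi_f)=n$ (i.e. $\mathrm{Allow}(S)$ is a disjoint union of half-open $n$-dimensional simplices). Non-commuting variables $x_1,x_2,\dots$, $\mathbf{x}_a=x_{a_1}\cdots x_{a_n}$, $\mathcal{M}_\Phi=\sum_{a\in\mathbb{N}^n,\Delta(a)=\Phi}\mathbf{x}_a$, $\mathcal{S}_S=\sum_{\Phi\text{ solves }S}\mathcal{M}_\Phi$, and the nc-fundamental basis is $\mathcal{L}_\Phi=\sum_{\Psi:\Phi\preceq\Psi}\mathcal{M}_\Psi$. The $h^*$-vector of $\chi_S$ is $(h^*_0,\dots,h^*_n)$ with $\chi_S(k)=\sum_{i=0}^n h^*_i\binom{k+n-i}{n}$. -}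

module Defs where

open import Data.Nat using (ℕ; zero; suc; _+_; _*_; _∸_; _≤_; _<_; _≤ᵇ_)
open import Data.Nat.Combinatorics using (_C_)
open import Data.Nat.ListAction using (sum)
open import Data.Bool using (Bool; true; false; not; _∧_; _∨_; if_then_else_; T)
open import Data.Fin as F using (Fin; toℕ)
open import Data.Vec using (Vec; lookup)
open import Data.Vec.Membership.Propositional using () renaming (_∈_ to _∈ᵥ_)
open import Data.List using (List; map; length)
import Data.List as L
open import Data.List.Membership.Propositional using (_∈_)
open import Data.List.Relation.Unary.Unique.Propositional using (Unique)
open import Data.List.Relation.Unary.All using (All)
open import Data.Product using (Σ; Σ-syntax; ∃; _×_; _,_; proj₁; proj₂)
open import Relation.Binary.PropositionalEquality using (_≡_)
open import Relation.Binary.Construct.Closure.ReflexiveTransitive using (Star)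
open import Relation.Nullary using (¬_)
open import Function.Bundles using (_⇔_)

-- Scheduling problems: boolean formulas in x₁..xₙ with atoms xᵢ ≤ xⱼ

data Formula (n : ℕ) : Set where
  atom  : Fin n → Fin n → Formula n
  neg   : Formula n → Formula n
  and   : Formula n → Formula n → Formula n
  or    : Formula n → Formula n → Formula n

eval : ∀ {n} → Formula n → (Fin n → ℕ) → Bool
eval (atom i j) a = a i ≤ᵇ a j
eval (neg S)    a = not (eval S a)
eval (and S T)  a = eval S a ∧ eval T a
eval (or S T)   a = eval S a ∨ eval T a

Holds : ∀ {n} → Formula n → (Fin n → ℕ) → Set
Holds S a = T (eval S a)

-- χ_S(k) = #{ a ∈ [k]ⁿ : S(a) },  [k] = {1,…,k}
consF : ∀ {n} → ℕ → (Fin n → ℕ) → (Fin (suc n) → ℕ)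
consF v a F.zero    = v
consF v a (F.suc i) = a i

countPts : (n k : ℕ) → ((Fin n → ℕ) → Bool) → ℕ
countPts zero    k p = if p (λ ()) then 1 else 0
countPts (suc n) k p =
  sum (map (λ v → countPts n k (λ a → p (consF (suc v) a))) (L.upTo k))

χ : ∀ {n} → Formula n → ℕ → ℕ
χ {n} S k = countPts n k (eval S)

-- Ordered set partitions of [n]
-- Φ = (ℓ , w) : w i is the index (0-based) of the block containing i.
-- It is an ordered set partition iff every block index is used (blocks nonempty).

OSP : ℕ → Set
OSP n = Σ[ ℓ ∈ ℕ ] Vec (Fin ℓ) n

len : ∀ {n} → OSP n → ℕ
len = proj₁

blk : ∀ {n} → (Φ : OSP n) → Fin n → Fin (len Φ)
blk (ℓ , w) i = lookup w i

IsOSP : ∀ {n} → OSP n → Set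
IsOSP (ℓ , w) = ∀ (b : Fin ℓ) → b ∈ᵥ w

HasPattern : ∀ {n} → (Fin n → ℕ) → OSP n → Set
HasPattern a Φ = ∀ i j →
  (blk Φ i ≡ blk Φ j → a i ≡ a j) × (blk Φ i F.< blk Φ j → a i < a j)

Solves : ∀ {n} → Formula n → OSP n → Set
Solves {n} S Φ = ∀ (a : Fin n → ℕ) → HasPattern a Φ → Holds S a

-- Ψ refines Φ : each block of Φ is a union of consecutive blocks of Ψ,
-- i.e. Φ is obtained from Ψ by a weakly increasing relabelling of blocks.
_Refines_ : ∀ {n} → OSP n → OSP n → Set
Ψ Refines Φ = Σ[ g ∈ (Fin (len Ψ) → Fin (len Φ)) ]
  ((∀ x y → x F.≤ y → g x F.≤ g y) × (∀ i → blk Φ i ≡ g (blk Ψ i)))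

mergeIdx : ℕ → ℕ → ℕ
mergeIdx m j = if j ≤ᵇ m then j else j ∸ 1

-- covering relation of directed refinement:
-- Φ = (Ψ₀,…,Ψ_{m-1}, Ψ_m ∪ Ψ_{m+1}, Ψ_{m+2},…) ⋖ Ψ  when every element of
-- Ψ_m is less than every element of Ψ_{m+1}
_⋖_ : ∀ {n} → OSP n → OSP n → Set
Φ ⋖ Ψ = IsOSP Φ × IsOSP Ψ × Σ[ m ∈ ℕ ] (
    (suc m < len Ψ)
  × (suc (len Φ) ≡ len Ψ)
  × (∀ x y → toℕ (blk Ψ x) ≡ m → toℕ (blk Ψ y) ≡ suc m → x F.< y)
  × (∀ x → toℕ (blk Φ x) ≡ mergeIdx m (toℕ (blk Ψ x))))

_⪯_ : ∀ {n} → OSP n → OSP n → Set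
_⪯_ = Star _⋖_

InInterval : ∀ {n} → OSP n → OSP n × OSP n → Set
InInterval Φ (Φc , Φf) = (Φ Refines Φc) × (Φf Refines Φ)

Partitionable : ∀ {n} → Formula n → Set
Partitionable {n} S = Σ[ I ∈ List (OSP n × OSP n) ] (
    All (λ p → IsOSP (proj₁ p) × IsOSP (proj₂ p) × (len (proj₂ p) ≡ n)
               × (proj₂ p Refines proj₁ p)) I
  × (∀ Φ → IsOSP Φ →
       (Solves S Φ → Σ[ k ∈ Fin (length I) ] (InInterval Φ (L.lookup I k)
            × (∀ k′ → InInterval Φ (L.lookup I k′) → k′ ≡ k)))
     × (∀ k → InInterval Φ (L.lookup I k) → Solves S Φ)))

-- Expansion of 𝒮_S in the nc-fundamental basis:
-- 𝒮_S = Σ_Φ c_Φ ℒ_Φ  ⇔  for every Ψ, [Ψ solves S] = Σ_{Φ ⪯ Ψ} c_Φ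
-- (comparing coefficients of the monomial basis ℳ_Ψ).

SumOver : ∀ {n} → (OSP n → Set) → (OSP n → ℕ) → ℕ → Set
SumOver {n} P c v = Σ[ xs ∈ List (OSP n) ]
  (Unique xs × (∀ Φ → (Φ ∈ xs) ⇔ P Φ) × (sum (map c xs) ≡ v))

FundamentalExpansion : ∀ {n} → Formula n → (OSP n → ℕ) → Set
FundamentalExpansion {n} S c = ∀ (Ψ : OSP n) → IsOSP Ψ →
    (Solves S Ψ → SumOver (λ Φ → IsOSP Φ × Φ ⪯ Ψ) c 1)
  × (¬ Solves S Ψ → SumOver (λ Φ → IsOSP Φ × Φ ⪯ Ψ) c 0)

ΣFin : (m : ℕ) → (Fin m → ℕ) → ℕ
ΣFin zero    f = 0
ΣFin (suc m) f = f F.zero + ΣFin m (λ i → f (F.suc i))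

HStarVector : ∀ {n} → Formula n → (Fin (suc n) → ℕ) → Set
HStarVector {n} S h = ∀ (k : ℕ) → 1 ≤ k →
  χ S k ≡ ΣFin (suc n) (λ i → h i * ((k + n ∸ toℕ i) C n))

ClosedUnderDirRef : ∀ {n} → Formula n → Set
ClosedUnderDirRef {n} S = ∀ (Φ Ψ : OSP n) → IsOSP Φ → Solves S Φ → Φ ⪯ Ψ → Solves S Ψ

-- Ψ is a coarsest (= ⪯-minimal) partition solving S among those ⪯ Φ
CoarsestBelow : ∀ {n} → Formula n → OSP n → OSP n → Set
CoarsestBelow {n} S Φ Ψ = IsOSP Ψ × Solves S Ψ × Ψ ⪯ Φ
  × (∀ (Θ : OSP n) → IsOSP Θ → Solves S Θ → Θ ⪯ Ψ → Θ ≡ Ψ)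

UniqueCoarsest : ∀ {n} → Formula n → Set
UniqueCoarsest {n} S = ∀ (Φ : OSP n) → IsOSP Φ → Solves S Φ →
  Σ[ Φc ∈ OSP n ] (CoarsestBelow S Φ Φc × (∀ Ψ → CoarsestBelow S Φ Ψ → Ψ ≡ Φc))

-- Directed refinement has a concrete description: Φ ⪯ Ψ iff Ψ refines Φ and any two items that
-- Φ puts together but Ψ separates appear in Ψ in increasing order.  So the partitions
-- above a ⪯-minimal solution Θ form exactly the interval [Θ, Φ_f] of the refinement order, where
-- Φ_f splits every block of Θ into singletons in increasing order.  Closure under ⪯ and the unique
-- coarsest solution below every solution make these intervals, one for each minimal solution, a
-- partition of the solutions.  Hence the fundamental coefficients are the indicator of minimality,
-- and since the lattice points of [k]ⁿ in the half-open cone of [Θ, Φ_f] number C(k + n - ℓ(Θ), n),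
-- h*_i is the number of minimal solutions with i blocks.
module Submission where

open import Defs

open import Algebra.Properties.CommutativeSemigroup using (interchange)
open import Data.Bool using (Bool; true; false; T; not; _∧_; _∨_; if_then_else_)
import Data.Bool.Properties as Bool
open import Data.Bool.Properties using (T?)
open import Data.Empty using (⊥; ⊥-elim)
open import Data.Fin as F using (Fin; toℕ; fromℕ<)
import Data.Fin.Properties as FP
open import Data.List using (List; []; _∷_; concatMap; upTo; allFin; filter; deduplicate)
import Data.List as L
import Data.List.Properties as LP
open import Data.List.Membership.Propositional using (_∈_; find)
open import Data.List.Membership.Propositional.Properties
open import Data.List.Membership.Propositional.Properties.WithK using (unique∧set⇒bag)
import Data.List.Membership.DecPropositional as LDec
open import Data.List.Relation.Binary.BagAndSetEquality using (∼bag⇒↭)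
open import Data.List.Relation.Binary.Permutation.Propositional using (_↭_)
import Data.List.Relation.Binary.Permutation.Propositional.Properties as PermP
open import Data.List.Relation.Unary.All as All using (All)
import Data.List.Relation.Unary.All.Properties as AllP
import Data.List.Relation.Unary.AllPairs as AP
open import Data.List.Relation.Unary.Any as Any using (here; there)
import Data.List.Relation.Unary.Any.Properties as AnyP
open import Data.List.Relation.Unary.Unique.Propositional using (Unique)
import Data.List.Relation.Unary.Unique.Propositional.Properties as UP
import Data.List.Relation.Unary.Unique.DecPropositional.Properties as UDP
open import Data.Nat using (ℕ; zero; suc; _+_; _*_; _∸_; _≤_; _<_; _≤ᵇ_; _≤?_; _<?_; z≤n; s≤s)
open import Data.Nat.Combinatorics using (_C_; k>n⇒nCk≡0; nCk+nC[k+1]≡[n+1]C[k+1]; nC1≡n)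
open import Data.Nat.ListAction using (sum)
open import Data.Nat.ListAction.Properties using (sum-++; sum-↭)
open import Data.Nat.Properties
open import Data.Product using (Σ-syntax; ∃-syntax; _×_; _,_; proj₁; proj₂)
open import Data.Product.Properties using (≡-dec)
open import Data.Sum using (_⊎_; inj₁; inj₂; [_,_])
open import Data.Unit using (⊤; tt)
open import Data.Vec using (Vec; []; _∷_; head; lookup; tabulate)
import Data.Vec.Properties as VP
import Data.Vec.Membership.DecPropositional as VDec
import Data.Vec.Membership.Propositional as VMem
import Data.Vec.Membership.Propositional.Properties as VMemP
import Data.Vec.Relation.Unary.Any as VAny
import Data.Vec.Relation.Unary.Any.Properties as VAnyP
open import Function using (_∘_)
open import Function.Bundles using (_⇔_; mk⇔; Equivalence)
open import Function.Definitions using (Injective)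
open import Relation.Binary.Consequences using (tri⇒dec<; tri⇒irr)
import Relation.Binary.Construct.Flip.EqAndOrd as Flip
open import Relation.Binary.Construct.Closure.ReflexiveTransitive using (ε; _◅_; _◅◅_)
open import Relation.Binary.Definitions using (DecidableEquality; Transitive; Trichotomous; tri<; tri≈; tri>)
open import Relation.Binary.PropositionalEquality hiding ([_])
open import Relation.Nullary using (¬_; Dec; yes; no; does)
open import Relation.Nullary.Decidable using (_×-dec_; _→-dec_; map′)

-- Ordered set partitions and directed refinement

blkℕ : ∀ {n} → OSP n → Fin n → ℕ
blkℕ Φ i = toℕ (blk Φ i)

blkℕ<len : ∀ {n} (Φ : OSP n) i → blkℕ Φ i < len Φ
blkℕ<len Φ i = FP.toℕ<n (blk Φ i)

lookup-ext : ∀ {A : Set} {n} {w w′ : Vec A n} → (∀ i → lookup w i ≡ lookup w′ i) → w ≡ w′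
lookup-ext {w = w} {w′} same = begin
  w                    ≡⟨ VP.tabulate∘lookup w ⟨
  tabulate (lookup w)  ≡⟨ VP.tabulate-cong same ⟩
  tabulate (lookup w′) ≡⟨ VP.tabulate∘lookup w′ ⟩
  w′                   ∎
  where open ≡-Reasoning

OSP-ext : ∀ {n} {Φ Ψ : OSP n} → len Φ ≡ len Ψ → (∀ i → blkℕ Φ i ≡ blkℕ Ψ i) → Φ ≡ Ψ
OSP-ext {Φ = ℓ , w} {.ℓ , w′} refl same = cong (ℓ ,_) (lookup-ext (FP.toℕ-injective ∘ same))

blkℕ-tabulate : ∀ {n ℓ} (f : Fin n → Fin ℓ) i → blkℕ (ℓ , tabulate f) i ≡ toℕ (f i)
blkℕ-tabulate f i = cong toℕ (VP.lookup∘tabulate f i)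

block-inhabited : ∀ {n} {Φ : OSP n} → IsOSP Φ → ∀ v → v < len Φ → ∃[ i ] blkℕ Φ i ≡ v
block-inhabited {Φ = Φ} osp v v< = VAny.index (osp b) ,
  trans (cong toℕ (sym (VAnyP.lookup-index (osp b)))) (FP.toℕ-fromℕ< v<)
  where
  b : Fin (len Φ)
  b = fromℕ< v<

inhabited⇒IsOSP : ∀ {n} (Φ : OSP n) → (∀ v → v < len Φ → ∃[ i ] blkℕ Φ i ≡ v) → IsOSP Φ
inhabited⇒IsOSP (ℓ , w) inh b with inh (toℕ b) (FP.toℕ<n b)
... | i , bi≡b = subst (VMem._∈ w) (FP.toℕ-injective bi≡b) (VMemP.∈-lookup i w)

mergeIdx-view : ∀ m j → (j ≤ m × mergeIdx m j ≡ j) ⊎ (m < j × suc (mergeIdx m j) ≡ j)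
mergeIdx-view m j with j ≤ᵇ m in eq
... | true  = inj₁ (≤ᵇ⇒≤ j m (subst T (sym eq) _) , refl)
... | false = inj₂ (m<j , m+[n∸m]≡n (≤-trans (s≤s z≤n) m<j))
  where
  m<j : m < j
  m<j = ≰⇒> (λ j≤m → subst T eq (≤⇒≤ᵇ j≤m))

mergeIdx-≤ : ∀ {m j} → j ≤ m → mergeIdx m j ≡ j
mergeIdx-≤ {m} {j} j≤m with mergeIdx-view m j
... | inj₁ (_ , e)   = e
... | inj₂ (m<j , _) = ⊥-elim (<⇒≱ m<j j≤m)

mergeIdx-> : ∀ {m j} → m < j → suc (mergeIdx m j) ≡ j
mergeIdx-> {m} {j} m<j with mergeIdx-view m j
... | inj₁ (j≤m , _) = ⊥-elim (<⇒≱ m<j j≤m)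
... | inj₂ (_ , e)   = e

mergeIdx-mono : ∀ m {a b} → a ≤ b → mergeIdx m a ≤ mergeIdx m b
mergeIdx-mono m {a} {b} a≤b with mergeIdx-view m a | mergeIdx-view m b
... | inj₁ (_ , ea)   | inj₁ (_ , eb)   = subst₂ _≤_ (sym ea) (sym eb) a≤b
... | inj₁ (a≤m , ea) | inj₂ (m<b , eb) =
  subst₂ _≤_ (sym ea) refl (≤-pred (subst (a <_) (sym eb) (≤-<-trans a≤m m<b)))
... | inj₂ (m<a , _)  | inj₁ (b≤m , _)  = ⊥-elim (<-irrefl refl (<-≤-trans m<a (≤-trans a≤b b≤m)))
... | inj₂ (_ , ea)   | inj₂ (_ , eb)   = ≤-pred (subst₂ _≤_ (sym ea) (sym eb) a≤b)

mergeIdx-reflects-≤ : ∀ m {a b} → mergeIdx m a ≤ mergeIdx m b → a ≤ b ⊎ (a ≡ suc m × b ≡ m)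
mergeIdx-reflects-≤ m {a} {b} le with mergeIdx-view m a | mergeIdx-view m b
... | inj₁ (_ , ea)   | inj₁ (_ , eb)   = inj₁ (subst₂ _≤_ ea eb le)
... | inj₁ (a≤m , _)  | inj₂ (m<b , _)  = inj₁ (≤-trans a≤m (<⇒≤ m<b))
... | inj₂ (m<a , ea) | inj₁ (b≤m , eb) = inj₂ (trans (sym ea) (cong suc a′≡m) , b≡m)
  where
  m≤a′ : m ≤ mergeIdx m a
  m≤a′ = ≤-pred (subst (m <_) (sym ea) m<a)
  a′≤b : mergeIdx m a ≤ b
  a′≤b = subst (mergeIdx m a ≤_) eb le
  a′≡m : mergeIdx m a ≡ m
  a′≡m = ≤-antisym (≤-trans a′≤b b≤m) m≤a′
  b≡m : b ≡ m
  b≡m = ≤-antisym b≤m (≤-trans m≤a′ a′≤b)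
... | inj₂ (_ , ea)   | inj₂ (_ , eb)   = inj₁ (subst₂ _≤_ ea eb (s≤s le))

mergeIdx-collision : ∀ m {a b} → mergeIdx m a ≡ mergeIdx m b → a < b → a ≡ m × b ≡ suc m
mergeIdx-collision m {a} {b} e a<b with mergeIdx-view m a | mergeIdx-view m b
... | inj₁ (_ , ea)   | inj₁ (_ , eb)   = ⊥-elim (<-irrefl (trans (sym ea) (trans e eb)) a<b)
... | inj₁ (a≤m , ea) | inj₂ (m<b , eb) = a≡m , trans (sym eb) (cong suc (trans (sym a≡b′) a≡m))
  where
  a≡b′ : a ≡ mergeIdx m b
  a≡b′ = trans (sym ea) e
  a≡m : a ≡ m
  a≡m = ≤-antisym a≤m (subst (m ≤_) (sym a≡b′) (≤-pred (subst (m <_) (sym eb) m<b)))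
... | inj₂ (m<a , _)  | inj₁ (b≤m , _)  = ⊥-elim (<-irrefl refl (<-trans m<a (<-≤-trans a<b b≤m)))
... | inj₂ (_ , ea)   | inj₂ (_ , eb)   = ⊥-elim (<-irrefl (trans (sym ea) (trans (cong suc e) eb)) a<b)

mergeIdx< : ∀ m {j L} → suc m < suc L → j < suc L → mergeIdx m j < L
mergeIdx< m {j} m< j< with mergeIdx-view m j
... | inj₁ (j≤m , e) = subst (_< _) (sym e) (≤-<-trans j≤m (≤-pred m<))
... | inj₂ (_ , e)   = ≤-pred (subst (_< _) (sym e) j<)

-- On ordered set partitions ⊑ is exactly ⪯.
record _⊑_ {n} (Φ Ψ : OSP n) : Set where
  field
    coarsens      : ∀ i j → blkℕ Ψ i ≤ blkℕ Ψ j → blkℕ Φ i ≤ blkℕ Φ j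
    splitsInOrder : ∀ i j → blkℕ Φ i ≡ blkℕ Φ j → blkℕ Ψ i < blkℕ Ψ j → toℕ i < toℕ j
open _⊑_

⊑-refl : ∀ {n} {Φ : OSP n} → Φ ⊑ Φ
⊑-refl = record { coarsens = λ _ _ le → le ; splitsInOrder = λ _ _ e lt → ⊥-elim (<-irrefl e lt) }

⊑-trans : ∀ {n} {Φ Θ Ψ : OSP n} → Φ ⊑ Θ → Θ ⊑ Ψ → Φ ⊑ Ψ
⊑-trans {Φ = Φ} {Θ} {Ψ} Φ⊑Θ Θ⊑Ψ = record
  { coarsens      = λ i j → coarsens Φ⊑Θ i j ∘ coarsens Θ⊑Ψ i j
  ; splitsInOrder = ordered }
  where
  ordered : ∀ i j → blkℕ Φ i ≡ blkℕ Φ j → blkℕ Ψ i < blkℕ Ψ j → toℕ i < toℕ j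
  ordered i j e lt with m≤n⇒m<n∨m≡n (coarsens Θ⊑Ψ i j (<⇒≤ lt))
  ... | inj₁ Θ< = splitsInOrder Φ⊑Θ i j e Θ<
  ... | inj₂ Θ≡ = splitsInOrder Θ⊑Ψ i j Θ≡ lt

⊑-sameBlock : ∀ {n} {Φ Ψ : OSP n} → Φ ⊑ Ψ → ∀ i j → blkℕ Ψ i ≡ blkℕ Ψ j → blkℕ Φ i ≡ blkℕ Φ j
⊑-sameBlock Φ⊑Ψ i j e =
  ≤-antisym (coarsens Φ⊑Ψ i j (≤-reflexive e)) (coarsens Φ⊑Ψ j i (≤-reflexive (sym e)))

⋖⇒⊑ : ∀ {n} {Φ Ψ : OSP n} → Φ ⋖ Ψ → Φ ⊑ Ψ
⋖⇒⊑ (_ , _ , m , _ , _ , ordered , merge) = record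
  { coarsens      = λ i j le → subst₂ _≤_ (sym (merge i)) (sym (merge j)) (mergeIdx-mono m le)
  ; splitsInOrder = λ i j e lt →
      let (i∈m , j∈m+1) = mergeIdx-collision m (trans (sym (merge i)) (trans e (merge j))) lt
      in ordered i j i∈m j∈m+1 }

⪯⇒⊑ : ∀ {n} {Φ Ψ : OSP n} → Φ ⪯ Ψ → Φ ⊑ Ψ
⪯⇒⊑ ε         = ⊑-refl
⪯⇒⊑ (s ◅ Θ⪯Ψ) = ⊑-trans (⋖⇒⊑ s) (⪯⇒⊑ Θ⪯Ψ)

⪯⇒len≤ : ∀ {n} {Φ Ψ : OSP n} → Φ ⪯ Ψ → len Φ ≤ len Ψ
⪯⇒len≤ ε                            = ≤-refl
⪯⇒len≤ ((_ , _ , _ , _ , e , _) ◅ p) = ≤-trans (≤-trans (n≤1+n _) (≤-reflexive e)) (⪯⇒len≤ p)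

MergedPair : ∀ {n} → OSP n → OSP n → Fin n → Fin n → Set
MergedPair Φ Ψ i j = blkℕ Ψ j ≡ suc (blkℕ Ψ i) × blkℕ Φ i ≡ blkℕ Φ j

mergedPair? : ∀ {n} (Φ Ψ : OSP n) → Dec (∃[ i ] ∃[ j ] MergedPair Φ Ψ i j)
mergedPair? Φ Ψ = FP.any? λ i → FP.any? λ j →
  (blkℕ Ψ j ≟ suc (blkℕ Ψ i)) ×-dec (blkℕ Φ i ≟ blkℕ Φ j)

module _ {n} {Φ Ψ : OSP n} (oΦ : IsOSP Φ) (oΨ : IsOSP Ψ) (Φ⊑Ψ : Φ ⊑ Ψ)
         (unmerged : ∀ i j → ¬ MergedPair Φ Ψ i j) where

  ⊑-unmerged⇒blkℕ≡ : ∀ b i → blkℕ Ψ i ≡ b → blkℕ Φ i ≡ b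
  ⊑-unmerged⇒blkℕ≡ zero i Ψi≡0 with block-inhabited oΦ 0 (≤-<-trans z≤n (blkℕ<len Φ i))
  ... | j , Φj≡0 = n≤0⇒n≡0 (subst (blkℕ Φ i ≤_) Φj≡0
                     (coarsens Φ⊑Ψ i j (subst (_≤ blkℕ Ψ j) (sym Ψi≡0) z≤n)))
  ⊑-unmerged⇒blkℕ≡ (suc b) i Ψi≡b+1
    with i′ , Ψi′≡b ← block-inhabited oΨ b (<-trans (n<1+n b) (subst (_< len Ψ) Ψi≡b+1 (blkℕ<len Ψ i)))
    = ≤-antisym (≮⇒≥ Φi≯b+1) b<Φi
    where
    Φi′≡b : blkℕ Φ i′ ≡ b
    Φi′≡b = ⊑-unmerged⇒blkℕ≡ b i′ Ψi′≡b
    b<Φi : b < blkℕ Φ i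
    b<Φi = subst (_< blkℕ Φ i) Φi′≡b (≤∧≢⇒<
      (coarsens Φ⊑Ψ i′ i (subst₂ _≤_ (sym Ψi′≡b) (sym Ψi≡b+1) (n≤1+n b)))
      (λ same → unmerged i′ i (trans Ψi≡b+1 (cong suc (sym Ψi′≡b)) , same)))
    Φi≯b+1 : suc b < blkℕ Φ i → ⊥
    Φi≯b+1 b+1<Φi with block-inhabited oΦ (suc b) (<-trans b+1<Φi (blkℕ<len Φ i))
    ... | j , Φj≡b+1 with ≤-<-connex (blkℕ Ψ j) b
    ...   | inj₁ Ψj≤b = 1+n≰n (subst₂ _≤_ Φj≡b+1 Φi′≡b
                          (coarsens Φ⊑Ψ j i′ (subst (blkℕ Ψ j ≤_) (sym Ψi′≡b) Ψj≤b)))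
    ...   | inj₂ b<Ψj = <-irrefl refl (<-≤-trans b+1<Φi (subst (blkℕ Φ i ≤_) Φj≡b+1
                          (coarsens Φ⊑Ψ i j (subst (_≤ blkℕ Ψ j) (sym Ψi≡b+1) b<Ψj))))

blkℕ≗⇒len≤ : ∀ {n} {Φ Ψ : OSP n} → IsOSP Φ → (∀ i → blkℕ Φ i ≡ blkℕ Ψ i) → len Φ ≤ len Ψ
blkℕ≗⇒len≤ {Φ = zero , _}  _   _    = z≤n
blkℕ≗⇒len≤ {Φ = suc ℓ , _} {Ψ} oΦ same with block-inhabited oΦ ℓ ≤-refl
... | i , Φi≡ℓ = subst (_< len Ψ) (trans (sym (same i)) Φi≡ℓ) (blkℕ<len Ψ i)

⊑-unmerged⇒≡ : ∀ {n} {Φ Ψ : OSP n} → IsOSP Φ → IsOSP Ψ → Φ ⊑ Ψ →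
               (∀ i j → ¬ MergedPair Φ Ψ i j) → Φ ≡ Ψ
⊑-unmerged⇒≡ {Φ = Φ} {Ψ} oΦ oΨ Φ⊑Ψ unmerged = OSP-ext
  (≤-antisym (blkℕ≗⇒len≤ {Ψ = Ψ} oΦ same) (blkℕ≗⇒len≤ {Ψ = Φ} oΨ (sym ∘ same))) same
  where
  same : ∀ i → blkℕ Φ i ≡ blkℕ Ψ i
  same i = ⊑-unmerged⇒blkℕ≡ oΦ oΨ Φ⊑Ψ unmerged (blkℕ Ψ i) i refl

Identifies : ∀ {n} → OSP n → OSP n → ℕ → Set
Identifies Φ Ψ m = ∀ x y → blkℕ Ψ x ≡ m → blkℕ Ψ y ≡ suc m → blkℕ Φ x ≡ blkℕ Φ y

mergedPair⇒identifies : ∀ {n} {Φ Ψ : OSP n} → Φ ⊑ Ψ → ∀ {i j} → MergedPair Φ Ψ i j →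
                        Identifies Φ Ψ (blkℕ Ψ i)
mergedPair⇒identifies Φ⊑Ψ {i} {j} (Ψj≡ , Φi≡Φj) x y Ψx≡ Ψy≡ =
  trans (⊑-sameBlock Φ⊑Ψ x i Ψx≡)
        (trans Φi≡Φj (⊑-sameBlock Φ⊑Ψ j y (trans Ψj≡ (sym Ψy≡))))

module _ {n L} (w : Vec (Fin (suc L)) n) (m : ℕ) (m< : suc m < suc L) where
  private
    Ψ : OSP n
    Ψ = suc L , w

  merged : OSP n
  merged = L , tabulate (λ x → fromℕ< (mergeIdx< m m< (blkℕ<len Ψ x)))

  blkℕ-merged : ∀ x → blkℕ merged x ≡ mergeIdx m (blkℕ Ψ x)
  blkℕ-merged x = trans (blkℕ-tabulate _ x) (FP.toℕ-fromℕ< _)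

  merged-isOSP : IsOSP Ψ → IsOSP merged
  merged-isOSP oΨ = inhabited⇒IsOSP merged inhabited
    where
    inhabited : ∀ v → v < L → ∃[ i ] blkℕ merged i ≡ v
    inhabited v v<L with ≤-<-connex v m
    ... | inj₁ v≤m with block-inhabited oΨ v (<-trans v<L (n<1+n L))
    ...   | i , Ψi≡v = i , trans (blkℕ-merged i) (trans (cong (mergeIdx m) Ψi≡v) (mergeIdx-≤ v≤m))
    inhabited v v<L | inj₂ m<v with block-inhabited oΨ (suc v) (s≤s v<L)
    ...   | i , Ψi≡v+1 = i , trans (blkℕ-merged i)
                               (trans (cong (mergeIdx m) Ψi≡v+1) (suc-injective (mergeIdx-> (m<n⇒m<1+n m<v))))

  module _ {Φ : OSP n} (Φ⊑Ψ : Φ ⊑ Ψ) (identifies : Identifies Φ Ψ m) where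

    merged⋖ : IsOSP Ψ → merged ⋖ Ψ
    merged⋖ oΨ = merged-isOSP oΨ , oΨ , m , m< , refl , ordered , blkℕ-merged
      where
      ordered : ∀ x y → blkℕ Ψ x ≡ m → blkℕ Ψ y ≡ suc m → x F.< y
      ordered x y Ψx≡m Ψy≡m+1 = splitsInOrder Φ⊑Ψ x y (identifies x y Ψx≡m Ψy≡m+1)
        (subst₂ _<_ (sym Ψx≡m) (sym Ψy≡m+1) (n<1+n m))

    ⊑-merged : Φ ⊑ merged
    ⊑-merged = record { coarsens = coarsens′ ; splitsInOrder = splitsInOrder′ }
      where
      coarsens′ : ∀ i j → blkℕ merged i ≤ blkℕ merged j → blkℕ Φ i ≤ blkℕ Φ j
      coarsens′ i j le with mergeIdx-reflects-≤ m (subst₂ _≤_ (blkℕ-merged i) (blkℕ-merged j) le)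
      ... | inj₁ Ψi≤Ψj             = coarsens Φ⊑Ψ i j Ψi≤Ψj
      ... | inj₂ (Ψi≡m+1 , Ψj≡m) = ≤-reflexive (sym (identifies j i Ψj≡m Ψi≡m+1))
      splitsInOrder′ : ∀ i j → blkℕ Φ i ≡ blkℕ Φ j → blkℕ merged i < blkℕ merged j → toℕ i < toℕ j
      splitsInOrder′ i j e lt = splitsInOrder Φ⊑Ψ i j e (≰⇒> λ Ψj≤Ψi → <-irrefl refl (<-≤-trans lt
        (subst₂ _≤_ (sym (blkℕ-merged j)) (sym (blkℕ-merged i)) (mergeIdx-mono m Ψj≤Ψi))))

-- Merge two adjacent blocks of Ψ that Φ identifies, and recurse on the number of blocks.
⊑⇒⪯ : ∀ {n} {Φ Ψ : OSP n} → IsOSP Φ → IsOSP Ψ → Φ ⊑ Ψ → Φ ⪯ Ψ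
⊑⇒⪯ {n} {Φ} {ℓ , w} oΦ = go ℓ w
  where
  go : ∀ ℓ (w : Vec (Fin ℓ) n) → IsOSP (ℓ , w) → Φ ⊑ (ℓ , w) → Φ ⪯ (ℓ , w)
  go ℓ w oΨ Φ⊑Ψ with mergedPair? Φ (ℓ , w)
  ... | no none = subst (Φ ⪯_) (⊑-unmerged⇒≡ oΦ oΨ Φ⊑Ψ (λ i j p → none (i , j , p))) ε
  go zero    w oΨ Φ⊑Ψ | yes (i , _) = ⊥-elim (n≮0 (blkℕ<len (zero , w) i))
  go (suc L) w oΨ Φ⊑Ψ | yes (i , j , pair) =
    go L (proj₂ (merged w m m<)) (merged-isOSP w m m< oΨ) (⊑-merged w m m< Φ⊑Ψ identifies)
      ◅◅ (merged⋖ w m m< Φ⊑Ψ identifies oΨ ◅ ε)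
    where
    m : ℕ
    m = blkℕ (suc L , w) i
    m< : suc m < suc L
    m< = subst (_< suc L) (proj₁ pair) (blkℕ<len (suc L , w) j)
    identifies : Identifies Φ (suc L , w) m
    identifies = mergedPair⇒identifies Φ⊑Ψ pair

-- Counting and ranking

indicator : ∀ {P : Set} → Dec P → ℕ
indicator (yes _) = 1
indicator (no _)  = 0

indicator-yes : ∀ {P : Set} (d : Dec P) → P → indicator d ≡ 1
indicator-yes (yes _) _ = refl
indicator-yes (no ¬p) p = ⊥-elim (¬p p)

indicator-no : ∀ {P : Set} (d : Dec P) → ¬ P → indicator d ≡ 0
indicator-no (yes p) ¬p = ⊥-elim (¬p p)
indicator-no (no _)  _  = refl

indicator-mono : ∀ {P Q : Set} (p : Dec P) (q : Dec Q) → (P → Q) → indicator p ≤ indicator q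
indicator-mono (yes p) q P⇒Q = ≤-reflexive (sym (indicator-yes q (P⇒Q p)))
indicator-mono (no _)  q P⇒Q = z≤n

indicator-cong : ∀ {P Q : Set} (p : Dec P) (q : Dec Q) → (P → Q) → (Q → P) → indicator p ≡ indicator q
indicator-cong p q P⇒Q Q⇒P = ≤-antisym (indicator-mono p q P⇒Q) (indicator-mono q p Q⇒P)

count : ∀ {n} {P : Fin n → Set} → (∀ x → Dec (P x)) → ℕ
count {n} P? = ΣFin n (indicator ∘ P?)

count-mono : ∀ {n} {P Q : Fin n → Set} (P? : ∀ x → Dec (P x)) (Q? : ∀ x → Dec (Q x)) →
             (∀ x → P x → Q x) → count P? ≤ count Q?
count-mono {zero}  P? Q? P⇒Q = z≤n
count-mono {suc n} P? Q? P⇒Q = +-mono-≤ (indicator-mono (P? F.zero) (Q? F.zero) (P⇒Q F.zero))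
                                        (count-mono (P? ∘ F.suc) (Q? ∘ F.suc) (P⇒Q ∘ F.suc))

count-strictMono : ∀ {n} {P Q : Fin n → Set} (P? : ∀ x → Dec (P x)) (Q? : ∀ x → Dec (Q x)) →
                   (∀ x → P x → Q x) → ∀ y → Q y → ¬ P y → count P? < count Q?
count-strictMono P? Q? P⇒Q F.zero qy ¬py rewrite indicator-no (P? F.zero) ¬py | indicator-yes (Q? F.zero) qy =
  s≤s (count-mono (P? ∘ F.suc) (Q? ∘ F.suc) (P⇒Q ∘ F.suc))
count-strictMono P? Q? P⇒Q (F.suc y) qy ¬py =
  +-mono-≤-< (indicator-mono (P? F.zero) (Q? F.zero) (P⇒Q F.zero))
             (count-strictMono (P? ∘ F.suc) (Q? ∘ F.suc) (P⇒Q ∘ F.suc) y qy ¬py)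

count<n : ∀ {n} {P : Fin n → Set} (P? : ∀ x → Dec (P x)) → ∀ y → ¬ P y → count P? < n
count<n {n} P? y ¬py = subst (count P? <_) (all-count n) (count-strictMono P? (λ _ → yes tt) (λ _ _ → tt) y tt ¬py)
  where
  all-count : ∀ n → count {n} (λ _ → yes tt) ≡ n
  all-count zero    = refl
  all-count (suc n) = cong suc (all-count n)

injective⇒surjective : ∀ {n} (f : Fin n → Fin n) → Injective _≡_ _≡_ f → ∀ v → ∃[ x ] f x ≡ v
injective⇒surjective {suc n} f f-inj v with FP.any? (λ x → f x FP.≟ v)
... | yes hit = hit
... | no miss = ⊥-elim (1+n≰n (FP.injective⇒≤ {f = avoid} avoid-injective))
  where
  miss-at : ∀ x → v ≢ f x
  miss-at x v≡fx = miss (x , sym v≡fx)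
  avoid : Fin (suc n) → Fin n
  avoid x = F.punchOut (miss-at x)
  avoid-injective : Injective _≡_ _≡_ avoid
  avoid-injective {x} {y} e = f-inj (FP.punchOut-injective (miss-at x) (miss-at y) e)

module Ranking {n} {_≺_ : Fin n → Fin n → Set}
               (≺-trans : Transitive _≺_) (compare : Trichotomous _≡_ _≺_) where

  _≺?_ : ∀ i j → Dec (i ≺ j)
  _≺?_ = tri⇒dec< compare

  rankℕ : Fin n → ℕ
  rankℕ i = count (_≺? i)

  rankℕ-strictMono : ∀ {i j} → i ≺ j → rankℕ i < rankℕ j
  rankℕ-strictMono {i} i≺j = count-strictMono _ _ (λ _ x≺i → ≺-trans x≺i i≺j) i i≺j (tri⇒irr compare refl)

  rankℕ≤⇒⊀ : ∀ {i j} → rankℕ i ≤ rankℕ j → ¬ j ≺ i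
  rankℕ≤⇒⊀ le j≺i = <-irrefl refl (<-≤-trans (rankℕ-strictMono j≺i) le)

  rankℕ-injective : ∀ {i j} → rankℕ i ≡ rankℕ j → i ≡ j
  rankℕ-injective {i} {j} e with compare i j
  ... | tri< i≺j _ _ = ⊥-elim (rankℕ≤⇒⊀ (≤-reflexive (sym e)) i≺j)
  ... | tri≈ _ i≡j _ = i≡j
  ... | tri> _ _ j≺i = ⊥-elim (rankℕ≤⇒⊀ (≤-reflexive e) j≺i)

  rank : Fin n → Fin n
  rank i = fromℕ< (count<n (_≺? i) i (tri⇒irr compare refl))

  toℕ-rank : ∀ i → toℕ (rank i) ≡ rankℕ i
  toℕ-rank i = FP.toℕ-fromℕ< _

  rank-injective : Injective _≡_ _≡_ rank
  rank-injective {i} {j} e = rankℕ-injective (trans (sym (toℕ-rank i)) (trans (cong toℕ e) (toℕ-rank j)))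

  opaque
    rank⁻¹ : Fin n → Fin n
    rank⁻¹ p = proj₁ (injective⇒surjective rank rank-injective p)

    rank∘rank⁻¹ : ∀ p → rank (rank⁻¹ p) ≡ p
    rank∘rank⁻¹ p = proj₂ (injective⇒surjective rank rank-injective p)

  rank⁻¹∘rank : ∀ i → rank⁻¹ (rank i) ≡ i
  rank⁻¹∘rank i = rank-injective (rank∘rank⁻¹ (rank i))

-- The finest refinement

refines⇒coarsens : ∀ {n} {Φ Ψ : OSP n} → Ψ Refines Φ → ∀ i j → blkℕ Ψ i ≤ blkℕ Ψ j → blkℕ Φ i ≤ blkℕ Φ j
refines⇒coarsens (g , g-mono , Φ≡g∘Ψ) i j le =
  subst₂ (λ a b → toℕ a ≤ toℕ b) (sym (Φ≡g∘Ψ i)) (sym (Φ≡g∘Ψ j)) (g-mono _ _ le)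

coarsens⇒refines : ∀ {n} {Φ Ψ : OSP n} → IsOSP Ψ →
                   (∀ i j → blkℕ Ψ i ≤ blkℕ Ψ j → blkℕ Φ i ≤ blkℕ Φ j) → Ψ Refines Φ
coarsens⇒refines {n} {Φ} {Ψ} oΨ coarsens′ = g , g-mono , Φ≡g∘Ψ
  where
  rep : Fin (len Ψ) → Fin n
  rep b = proj₁ (block-inhabited oΨ (toℕ b) (FP.toℕ<n b))
  Ψ∘rep : ∀ b → blk Ψ (rep b) ≡ b
  Ψ∘rep b = FP.toℕ-injective (proj₂ (block-inhabited oΨ (toℕ b) (FP.toℕ<n b)))
  g : Fin (len Ψ) → Fin (len Φ)
  g b = blk Φ (rep b)
  g-mono : ∀ x y → x F.≤ y → g x F.≤ g y
  g-mono x y le = coarsens′ (rep x) (rep y) (subst₂ F._≤_ (sym (Ψ∘rep x)) (sym (Ψ∘rep y)) le)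
  Φ≡g∘Ψ : ∀ i → blk Φ i ≡ g (blk Ψ i)
  Φ≡g∘Ψ i = FP.toℕ-injective (≤-antisym (coarsens′ i r (≤-reflexive Ψi≡Ψr)) (coarsens′ r i (≤-reflexive (sym Ψi≡Ψr))))
    where
    r : Fin n
    r = rep (blk Ψ i)
    Ψi≡Ψr : blkℕ Ψ i ≡ blkℕ Ψ r
    Ψi≡Ψr = cong toℕ (sym (Ψ∘rep (blk Ψ i)))

module Finest {n} (Θ : OSP n) where

  _≺_ : Fin n → Fin n → Set
  i ≺ j = blkℕ Θ i < blkℕ Θ j ⊎ (blkℕ Θ i ≡ blkℕ Θ j × toℕ i < toℕ j)

  ≺-trans : Transitive _≺_
  ≺-trans (inj₁ x) (inj₁ y)             = inj₁ (<-trans x y)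
  ≺-trans (inj₁ x) (inj₂ (e , _))       = inj₁ (subst (_ <_) e x)
  ≺-trans (inj₂ (e , _)) (inj₁ y)       = inj₁ (subst (_< _) (sym e) y)
  ≺-trans (inj₂ (e , x)) (inj₂ (e′ , y)) = inj₂ (trans e e′ , <-trans x y)

  ≺-compare : Trichotomous _≡_ _≺_
  ≺-compare i j with <-cmp (blkℕ Θ i) (blkℕ Θ j) | <-cmp (toℕ i) (toℕ j)
  ... | tri< b< b≢ b≯ | _ = tri< (inj₁ b<) (λ { refl → b≢ refl }) [ b≯ , b≢ ∘ sym ∘ proj₁ ]
  ... | tri> b≮ b≢ b> | _ = tri> [ b≮ , b≢ ∘ proj₁ ] (λ { refl → b≢ refl }) (inj₁ b>)
  ... | tri≈ b≮ b≡ b≯ | tri< i< i≢ i≯ = tri< (inj₂ (b≡ , i<)) (λ { refl → i≢ refl }) [ b≯ , i≯ ∘ proj₂ ]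
  ... | tri≈ b≮ b≡ b≯ | tri≈ i≮ i≡ i≯ = tri≈ [ b≮ , i≮ ∘ proj₂ ] (FP.toℕ-injective i≡) [ b≯ , i≯ ∘ proj₂ ]
  ... | tri≈ b≮ b≡ b≯ | tri> i≮ i≢ i> = tri> [ b≮ , i≮ ∘ proj₂ ] (λ { refl → i≢ refl }) (inj₂ (sym b≡ , i>))

  open Ranking ≺-trans ≺-compare public

  finest : OSP n
  finest = n , tabulate rank

  blkℕ-finest : ∀ i → blkℕ finest i ≡ rankℕ i
  blkℕ-finest i = trans (blkℕ-tabulate rank i) (toℕ-rank i)

  finest-isOSP : IsOSP finest
  finest-isOSP = inhabited⇒IsOSP finest λ v v<n →
    rank⁻¹ (fromℕ< v<n) ,
    trans (blkℕ-tabulate rank _) (trans (cong toℕ (rank∘rank⁻¹ _)) (FP.toℕ-fromℕ< v<n))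

  finest-splitsInOrder : ∀ {i j} → blkℕ Θ i ≡ blkℕ Θ j → rankℕ i < rankℕ j → toℕ i < toℕ j
  finest-splitsInOrder {i} {j} e lt with ≺-compare i j
  ... | tri< (inj₁ b<) _ _       = ⊥-elim (<-irrefl e b<)
  ... | tri< (inj₂ (_ , i<)) _ _ = i<
  ... | tri≈ _ refl _            = ⊥-elim (<-irrefl refl lt)
  ... | tri> _ _ j≺i             = ⊥-elim (rankℕ≤⇒⊀ (<⇒≤ lt) j≺i)

  ⊑-finest : Θ ⊑ finest
  ⊑-finest = record
    { coarsens      = λ i j le → ≮⇒≥ λ Θj<Θi → rankℕ≤⇒⊀ (subst₂ _≤_ (blkℕ-finest i) (blkℕ-finest j) le) (inj₁ Θj<Θi)
    ; splitsInOrder = λ i j e lt → finest-splitsInOrder e (subst₂ _<_ (blkℕ-finest i) (blkℕ-finest j) lt) }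

  ⊑⇒⊑finest : ∀ {Φ : OSP n} → Θ ⊑ Φ → Φ ⊑ finest
  ⊑⇒⊑finest {Φ} Θ⊑Φ = record { coarsens = coarsens′ ; splitsInOrder = splitsInOrder′ }
    where
    coarsens′ : ∀ i j → blkℕ finest i ≤ blkℕ finest j → blkℕ Φ i ≤ blkℕ Φ j
    coarsens′ i j le = ≮⇒≥ λ Φj<Φi → rankℕ≤⇒⊀ (subst₂ _≤_ (blkℕ-finest i) (blkℕ-finest j) le)
      (lex (m≤n⇒m<n∨m≡n (coarsens Θ⊑Φ j i (<⇒≤ Φj<Φi))) Φj<Φi)
      where
      lex : blkℕ Θ j < blkℕ Θ i ⊎ blkℕ Θ j ≡ blkℕ Θ i → blkℕ Φ j < blkℕ Φ i → j ≺ i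
      lex (inj₁ Θ<) _  = inj₁ Θ<
      lex (inj₂ Θ≡) Φ< = inj₂ (Θ≡ , splitsInOrder Θ⊑Φ j i Θ≡ Φ<)
    splitsInOrder′ : ∀ i j → blkℕ Φ i ≡ blkℕ Φ j → blkℕ finest i < blkℕ finest j → toℕ i < toℕ j
    splitsInOrder′ i j e lt = finest-splitsInOrder (⊑-sameBlock Θ⊑Φ i j e)
                                (subst₂ _<_ (blkℕ-finest i) (blkℕ-finest j) lt)

  inInterval⇒⊑ : ∀ {Φ : OSP n} → InInterval Φ (Θ , finest) → Θ ⊑ Φ
  inInterval⇒⊑ {Φ} (Φ-refines-Θ , finest-refines-Φ) = record
    { coarsens      = refines⇒coarsens {Φ = Θ} {Φ} Φ-refines-Θ
    ; splitsInOrder = λ i j e Φi<Φj → finest-splitsInOrder e (≰⇒> λ le → <-irrefl refl (<-≤-trans Φi<Φj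
        (refines⇒coarsens {Φ = Φ} {finest} finest-refines-Φ j i (subst₂ _≤_ (sym (blkℕ-finest j)) (sym (blkℕ-finest i)) le)))) }

  ⊑⇒inInterval : ∀ {Φ : OSP n} → IsOSP Φ → Θ ⊑ Φ → InInterval Φ (Θ , finest)
  ⊑⇒inInterval {Φ} oΦ Θ⊑Φ = coarsens⇒refines {Φ = Θ} oΦ (coarsens Θ⊑Φ)
                          , coarsens⇒refines {Φ = Φ} finest-isOSP (coarsens (⊑⇒⊑finest Θ⊑Φ))

-- Decidability and enumeration

eval-orderInvariant : ∀ {n} (S : Formula n) (a b : Fin n → ℕ) →
                      (∀ i j → (a i ≤ᵇ a j) ≡ (b i ≤ᵇ b j)) → eval S a ≡ eval S b
eval-orderInvariant (atom i j) a b same = same i j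
eval-orderInvariant (neg S)    a b same = cong not (eval-orderInvariant S a b same)
eval-orderInvariant (and S S′) a b same = cong₂ _∧_ (eval-orderInvariant S a b same) (eval-orderInvariant S′ a b same)
eval-orderInvariant (or S S′)  a b same = cong₂ _∨_ (eval-orderInvariant S a b same) (eval-orderInvariant S′ a b same)

≤ᵇ-cong : ∀ {a b c d} → (a ≤ b → c ≤ d) → (c ≤ d → a ≤ b) → (a ≤ᵇ b) ≡ (c ≤ᵇ d)
≤ᵇ-cong {a} {b} {c} {d} ⇒ ⇐ = Bool.⇔→≡ {z = true} (mk⇔
  (λ e → Equivalence.to Bool.T-≡ (≤⇒≤ᵇ (⇒ (≤ᵇ⇒≤ a b (Equivalence.from Bool.T-≡ e)))))
  (λ e → Equivalence.to Bool.T-≡ (≤⇒≤ᵇ (⇐ (≤ᵇ⇒≤ c d (Equivalence.from Bool.T-≡ e))))))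

module _ {n} {a : Fin n → ℕ} {Φ : OSP n} (pat : HasPattern a Φ) where

  pattern-< : ∀ i j → blkℕ Φ i < blkℕ Φ j → a i < a j
  pattern-< i j = proj₂ (pat i j)

  pattern-≤ : ∀ i j → blkℕ Φ i ≤ blkℕ Φ j → a i ≤ a j
  pattern-≤ i j le with m≤n⇒m<n∨m≡n le
  ... | inj₁ lt = <⇒≤ (pattern-< i j lt)
  ... | inj₂ e  = ≤-reflexive (proj₁ (pat i j) (FP.toℕ-injective e))

  pattern-reflects-< : ∀ i j → a i < a j → blkℕ Φ i < blkℕ Φ j
  pattern-reflects-< i j lt = ≰⇒> λ le → <-irrefl refl (<-≤-trans lt (pattern-≤ j i le))

  pattern-reflects-≤ : ∀ i j → a i ≤ a j → blkℕ Φ i ≤ blkℕ Φ j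
  pattern-reflects-≤ i j le = ≮⇒≥ λ lt → <-irrefl refl (<-≤-trans (pattern-< j i lt) le)

  pattern-≤ᵇ : ∀ i j → (a i ≤ᵇ a j) ≡ (blkℕ Φ i ≤ᵇ blkℕ Φ j)
  pattern-≤ᵇ i j = ≤ᵇ-cong (pattern-reflects-≤ i j) (pattern-≤ i j)

blkℕ-hasPattern : ∀ {n} (Φ : OSP n) → HasPattern (blkℕ Φ) Φ
blkℕ-hasPattern Φ i j = cong toℕ , λ lt → lt

holds⇒solves : ∀ {n} (S : Formula n) {Φ : OSP n} {a} → HasPattern a Φ → Holds S a → Solves S Φ
holds⇒solves S {Φ} {a} pa Sa b pb = subst T
  (trans (eval-orderInvariant S a (blkℕ Φ) (pattern-≤ᵇ {Φ = Φ} pa))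
         (sym (eval-orderInvariant S b (blkℕ Φ) (pattern-≤ᵇ {Φ = Φ} pb)))) Sa

solves? : ∀ {n} (S : Formula n) (Φ : OSP n) → Dec (Solves S Φ)
solves? S Φ with T? (eval S (blkℕ Φ))
... | yes holds = yes (λ a pa → holds⇒solves S {Φ} (blkℕ-hasPattern Φ) holds a pa)
... | no ¬holds = no (λ solves → ¬holds (solves (blkℕ Φ) (blkℕ-hasPattern Φ)))

_≟OSP_ : ∀ {n} → DecidableEquality (OSP n)
_≟OSP_ = ≡-dec _≟_ (VP.≡-dec FP._≟_)

isOSP? : ∀ {n} (Φ : OSP n) → Dec (IsOSP Φ)
isOSP? (ℓ , w) = FP.all? (λ b → VDec._∈?_ FP._≟_ b w)

_⊑?_ : ∀ {n} (Φ Ψ : OSP n) → Dec (Φ ⊑ Ψ)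
Φ ⊑? Ψ = map′ (λ (c , s) → record { coarsens = c ; splitsInOrder = s })
              (λ Φ⊑Ψ → coarsens Φ⊑Ψ , splitsInOrder Φ⊑Ψ)
  ((FP.all? λ i → FP.all? λ j → (blkℕ Ψ i ≤? blkℕ Ψ j) →-dec (blkℕ Φ i ≤? blkℕ Φ j))
   ×-dec
   (FP.all? λ i → FP.all? λ j →
      (blkℕ Φ i ≟ blkℕ Φ j) →-dec ((blkℕ Ψ i <? blkℕ Ψ j) →-dec (toℕ i <? toℕ j))))

allVecs : ∀ ℓ n → List (Vec (Fin ℓ) n)
allVecs ℓ zero    = [] ∷ []
allVecs ℓ (suc n) = concatMap (λ x → L.map (x ∷_) (allVecs ℓ n)) (allFin ℓ)

∈-allVecs : ∀ {ℓ n} (w : Vec (Fin ℓ) n) → w ∈ allVecs ℓ n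
∈-allVecs []               = here refl
∈-allVecs {ℓ} {suc n} (x ∷ w) = ∈-concatMap⁺ (λ x → L.map (x ∷_) (allVecs ℓ n)) {xs = allFin ℓ}
  (Any.map (λ { refl → ∈-map⁺ (x ∷_) (∈-allVecs w) }) (∈-allFin x))

labellings≤ : ∀ n → ℕ → List (OSP n)
labellings≤ n L = concatMap (λ ℓ → L.map (ℓ ,_) (allVecs ℓ n)) (upTo (suc L))

∈-labellings≤ : ∀ {n L} (Φ : OSP n) → len Φ ≤ L → Φ ∈ labellings≤ n L
∈-labellings≤ {n} {L} (ℓ , w) ℓ≤L = ∈-concatMap⁺ (λ ℓ → L.map (ℓ ,_) (allVecs ℓ n)) {xs = upTo (suc L)}
  (Any.map (λ { refl → ∈-map⁺ (ℓ ,_) (∈-allVecs w) }) (∈-upTo⁺ (s≤s ℓ≤L)))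

unique⇒lookup-injective : ∀ {A : Set} {xs : List A} → Unique xs → ∀ i j → L.lookup xs i ≡ L.lookup xs j → i ≡ j
unique⇒lookup-injective (_ AP.∷ _)          F.zero    F.zero    _ = refl
unique⇒lookup-injective (x∉xs AP.∷ _)       F.zero    (F.suc j) e = ⊥-elim (All.lookup x∉xs (∈-lookup j) e)
unique⇒lookup-injective (x∉xs AP.∷ _)       (F.suc i) F.zero    e = ⊥-elim (All.lookup x∉xs (∈-lookup i) (sym e))
unique⇒lookup-injective (_ AP.∷ unique-xs) (F.suc i) (F.suc j) e = cong F.suc (unique⇒lookup-injective unique-xs i j e)

sum-zero : ∀ {A : Set} (f : A → ℕ) (xs : List A) → (∀ x → x ∈ xs → f x ≡ 0) → sum (L.map f xs) ≡ 0
sum-zero f []       _      = refl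
sum-zero f (x ∷ xs) vanish = cong₂ _+_ (vanish x (here refl)) (sum-zero f xs (λ y → vanish y ∘ there))

sum-single : ∀ {A : Set} (f : A → ℕ) {xs : List A} {x₀} → Unique xs → x₀ ∈ xs →
             (∀ x → x ∈ xs → x ≢ x₀ → f x ≡ 0) → sum (L.map f xs) ≡ f x₀
sum-single f {x ∷ xs} (x∉xs AP.∷ _) (here refl) vanish = trans
  (cong (f x +_) (sum-zero f xs (λ y y∈xs → vanish y (there y∈xs) λ { refl → All.lookup x∉xs y∈xs refl })))
  (+-identityʳ _)
sum-single f {x ∷ xs} (x∉xs AP.∷ unique-xs) (there x₀∈xs) vanish = cong₂ _+_
  (vanish x (here refl) (λ { refl → All.lookup x∉xs x₀∈xs refl }))
  (sum-single f unique-xs x₀∈xs (λ y → vanish y ∘ there))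

predecessors : ∀ {n} → OSP n → List (OSP n)
predecessors {n} Ψ = deduplicate _≟OSP_ (filter (λ Φ → isOSP? Φ ×-dec Φ ⊑? Ψ) (labellings≤ n (len Ψ)))

predecessors-unique : ∀ {n} (Ψ : OSP n) → Unique (predecessors Ψ)
predecessors-unique Ψ = UDP.deduplicate-! _≟OSP_ _

∈-predecessors⇔ : ∀ {n} {Ψ : OSP n} → IsOSP Ψ → ∀ Φ → (Φ ∈ predecessors Ψ) ⇔ (IsOSP Φ × Φ ⪯ Ψ)
∈-predecessors⇔ {n} {Ψ} oΨ Φ = mk⇔ to from
  where
  P? : ∀ Φ → Dec (IsOSP Φ × Φ ⊑ Ψ)
  P? Φ = isOSP? Φ ×-dec Φ ⊑? Ψ
  to : Φ ∈ predecessors Ψ → IsOSP Φ × Φ ⪯ Ψ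
  to Φ∈ with (oΦ , Φ⊑Ψ) ← proj₂ (∈-filter⁻ P? {xs = labellings≤ n (len Ψ)} (∈-deduplicate⁻ _≟OSP_ _ Φ∈))
    = oΦ , ⊑⇒⪯ oΦ oΨ Φ⊑Ψ
  from : IsOSP Φ × Φ ⪯ Ψ → Φ ∈ predecessors Ψ
  from (oΦ , Φ⪯Ψ) = ∈-deduplicate⁺ _≟OSP_ (∈-filter⁺ P? (∈-labellings≤ Φ (⪯⇒len≤ Φ⪯Ψ)) (oΦ , ⪯⇒⊑ Φ⪯Ψ))

-- Minimal solutions and the partition into intervals

MinimalSolution : ∀ {n} → Formula n → OSP n → Set
MinimalSolution {n} S Θ = IsOSP Θ × Solves S Θ × (∀ (Ξ : OSP n) → IsOSP Ξ → Solves S Ξ → Ξ ⪯ Θ → Ξ ≡ Θ)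

module Decomposition {n} {S : Formula n} (closed : ClosedUnderDirRef S) (unique : UniqueCoarsest S) where

  module _ {Φ : OSP n} (oΦ : IsOSP Φ) (sΦ : Solves S Φ) where

    coarsest : OSP n
    coarsest = proj₁ (unique Φ oΦ sΦ)

    coarsest-below : CoarsestBelow S Φ coarsest
    coarsest-below = proj₁ (proj₂ (unique Φ oΦ sΦ))

    coarsest⪯ : coarsest ⪯ Φ
    coarsest⪯ = proj₁ (proj₂ (proj₂ coarsest-below))

    coarsest-minimal : MinimalSolution S coarsest
    coarsest-minimal = let (o , s , _ , min) = coarsest-below in o , s , min

    minimal⪯⇒≡coarsest : ∀ {Θ} → MinimalSolution S Θ → Θ ⪯ Φ → Θ ≡ coarsest
    minimal⪯⇒≡coarsest (o , s , min) Θ⪯Φ = proj₂ (proj₂ (unique Φ oΦ sΦ)) _ (o , s , Θ⪯Φ , min)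

  coarsestOf : OSP n → List (OSP n)
  coarsestOf Φ with isOSP? Φ ×-dec solves? S Φ
  ... | yes (oΦ , sΦ) = coarsest oΦ sΦ ∷ []
  ... | no _          = []

  ∈-coarsestOf⇒minimal : ∀ Φ {Θ} → Θ ∈ coarsestOf Φ → MinimalSolution S Θ
  ∈-coarsestOf⇒minimal Φ Θ∈ with isOSP? Φ ×-dec solves? S Φ | Θ∈
  ... | yes (oΦ , sΦ) | here refl = coarsest-minimal oΦ sΦ

  opaque
    minimals : List (OSP n)
    minimals = deduplicate _≟OSP_ (concatMap coarsestOf (labellings≤ n n))

    minimals-unique : Unique minimals
    minimals-unique = UDP.deduplicate-! _≟OSP_ _

    ∈-minimals⇒minimal : ∀ {Θ} → Θ ∈ minimals → MinimalSolution S Θ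
    ∈-minimals⇒minimal Θ∈ with (Φ , _ , Θ∈coarsestOfΦ) ← find (∈-concatMap⁻ coarsestOf {xs = labellings≤ n n}
                                                           (∈-deduplicate⁻ _≟OSP_ _ Θ∈))
      = ∈-coarsestOf⇒minimal Φ Θ∈coarsestOfΦ

    minimal⇒∈-minimals : ∀ {Θ} → MinimalSolution S Θ → Θ ∈ minimals
    minimal⇒∈-minimals {Θ} mΘ@(oΘ , sΘ , _) = ∈-deduplicate⁺ _≟OSP_ (∈-concatMap⁺ coarsestOf
      (Any.map (λ { refl → Θ∈coarsestOf }) (∈-labellings≤ finest ≤-refl)))
      where
      open Finest Θ using (finest; finest-isOSP; ⊑-finest)
      Θ⪯finest : Θ ⪯ finest
      Θ⪯finest = ⊑⇒⪯ oΘ finest-isOSP ⊑-finest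
      Θ∈coarsestOf : Θ ∈ coarsestOf finest
      Θ∈coarsestOf with isOSP? finest ×-dec solves? S finest
      ... | yes (o , s) = here (minimal⪯⇒≡coarsest o s mΘ Θ⪯finest)
      ... | no ¬os      = ⊥-elim (¬os (finest-isOSP , closed Θ finest oΘ sΘ Θ⪯finest))

  module _ {Φ : OSP n} (oΦ : IsOSP Φ) (sΦ : Solves S Φ) where

    coarsest-∈-minimals : coarsest oΦ sΦ ∈ minimals
    coarsest-∈-minimals = minimal⇒∈-minimals (coarsest-minimal oΦ sΦ)

    ∈-minimals-⪯⇒≡coarsest : ∀ {Θ} → Θ ∈ minimals → Θ ⪯ Φ → Θ ≡ coarsest oΦ sΦ
    ∈-minimals-⪯⇒≡coarsest Θ∈ = minimal⪯⇒≡coarsest oΦ sΦ (∈-minimals⇒minimal Θ∈)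

  interval : OSP n → OSP n × OSP n
  interval Θ = Θ , Finest.finest Θ

  intervals : List (OSP n × OSP n)
  intervals = L.map interval minimals

  intervals-lookup : ∀ k → ∃[ Θ ] (Θ ∈ minimals × L.lookup intervals k ≡ interval Θ)
  intervals-lookup k = ∈-map⁻ interval (∈-lookup {xs = intervals} k)

  inInterval⇒⪯ : ∀ {Φ Θ} → IsOSP Φ → MinimalSolution S Θ → InInterval Φ (interval Θ) → Θ ⪯ Φ
  inInterval⇒⪯ {Θ = Θ} oΦ (oΘ , _) Φ∈ = ⊑⇒⪯ oΘ oΦ (Finest.inInterval⇒⊑ Θ Φ∈)

  inInterval-unique : ∀ {Φ} (oΦ : IsOSP Φ) (sΦ : Solves S Φ) k → InInterval Φ (L.lookup intervals k) →
                      L.lookup intervals k ≡ interval (coarsest oΦ sΦ)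
  inInterval-unique {Φ} oΦ sΦ k Φ∈ =
    let (Θ , Θ∈ , lookup≡) = intervals-lookup k
    in trans lookup≡ (cong interval (∈-minimals-⪯⇒≡coarsest oΦ sΦ Θ∈
         (inInterval⇒⪯ oΦ (∈-minimals⇒minimal Θ∈) (subst (InInterval Φ) lookup≡ Φ∈))))

  partitionable : Partitionable S
  partitionable = intervals , AllP.map⁺ (All.tabulate isInterval) , covers
    where
    isInterval : ∀ {Θ} → Θ ∈ minimals → let (Φc , Φf) = interval Θ in
                 IsOSP Φc × IsOSP Φf × (len Φf ≡ n) × (Φf Refines Φc)
    isInterval {Θ} Θ∈ = proj₁ (∈-minimals⇒minimal Θ∈) , finest-isOSP , refl ,
                        coarsens⇒refines {Φ = Θ} finest-isOSP (coarsens ⊑-finest)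
      where open Finest Θ
    covers : ∀ Φ → IsOSP Φ →
      (Solves S Φ → Σ[ k ∈ Fin (L.length intervals) ] (InInterval Φ (L.lookup intervals k)
                      × (∀ k′ → InInterval Φ (L.lookup intervals k′) → k′ ≡ k)))
      × (∀ k → InInterval Φ (L.lookup intervals k) → Solves S Φ)
    covers Φ oΦ = inSome , solvesIfIn
      where
      solvesIfIn : ∀ k → InInterval Φ (L.lookup intervals k) → Solves S Φ
      solvesIfIn k Φ∈ =
        let (Θ , Θ∈ , lookup≡) = intervals-lookup k
            mΘ@(oΘ , sΘ , _) = ∈-minimals⇒minimal Θ∈
        in closed Θ Φ oΘ sΘ (inInterval⇒⪯ oΦ mΘ (subst (InInterval Φ) lookup≡ Φ∈))
      inSome : Solves S Φ → Σ[ k ∈ Fin (L.length intervals) ] (InInterval Φ (L.lookup intervals k)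
                              × (∀ k′ → InInterval Φ (L.lookup intervals k′) → k′ ≡ k))
      inSome sΦ = k , subst (InInterval Φ) (sym lookup≡) Φ∈ , onlyK
        where
        c∈ : interval (coarsest oΦ sΦ) ∈ intervals
        c∈ = ∈-map⁺ interval (coarsest-∈-minimals oΦ sΦ)
        k : Fin (L.length intervals)
        k = Any.index c∈
        lookup≡ : L.lookup intervals k ≡ interval (coarsest oΦ sΦ)
        lookup≡ = sym (AnyP.lookup-index c∈)
        Φ∈ : InInterval Φ (interval (coarsest oΦ sΦ))
        Φ∈ = Finest.⊑⇒inInterval (coarsest oΦ sΦ) oΦ (⪯⇒⊑ (coarsest⪯ oΦ sΦ))
        onlyK : ∀ k′ → InInterval Φ (L.lookup intervals k′) → k′ ≡ k
        onlyK k′ Φ∈′ = unique⇒lookup-injective (UP.map⁺ (cong proj₁) minimals-unique) k′ k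
          (trans (inInterval-unique oΦ sΦ k′ Φ∈′) (sym lookup≡))

  minimalIndicator : OSP n → ℕ
  minimalIndicator Θ = indicator (LDec._∈?_ _≟OSP_ Θ minimals)

  fundamentalExpansion : FundamentalExpansion S minimalIndicator
  fundamentalExpansion Ψ oΨ = sum≡1 , sum≡0
    where
    below : List (OSP n)
    below = predecessors Ψ
    below⇔ : ∀ Φ → (Φ ∈ below) ⇔ (IsOSP Φ × Φ ⪯ Ψ)
    below⇔ = ∈-predecessors⇔ oΨ
    sum≡1 : Solves S Ψ → SumOver (λ Φ → IsOSP Φ × Φ ⪯ Ψ) minimalIndicator 1
    sum≡1 sΨ = below , predecessors-unique Ψ , below⇔ ,
      trans (sum-single minimalIndicator (predecessors-unique Ψ) c∈below others)
            (indicator-yes (LDec._∈?_ _≟OSP_ c minimals) (coarsest-∈-minimals oΨ sΨ))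
      where
      c : OSP n
      c = coarsest oΨ sΨ
      c∈below : c ∈ below
      c∈below = Equivalence.from (below⇔ c) (proj₁ (coarsest-minimal oΨ sΨ) , coarsest⪯ oΨ sΨ)
      others : ∀ Φ → Φ ∈ below → Φ ≢ c → minimalIndicator Φ ≡ 0
      others Φ Φ∈ Φ≢c = indicator-no (LDec._∈?_ _≟OSP_ Φ minimals) λ Φ∈minimals →
        Φ≢c (∈-minimals-⪯⇒≡coarsest oΨ sΨ Φ∈minimals (proj₂ (Equivalence.to (below⇔ Φ) Φ∈)))
    sum≡0 : ¬ Solves S Ψ → SumOver (λ Φ → IsOSP Φ × Φ ⪯ Ψ) minimalIndicator 0
    sum≡0 ¬sΨ = below , predecessors-unique Ψ , below⇔ , sum-zero minimalIndicator below λ Φ Φ∈ →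
      indicator-no (LDec._∈?_ _≟OSP_ Φ minimals) λ Φ∈minimals →
        let (oΦ , sΦ , _) = ∈-minimals⇒minimal Φ∈minimals
        in ¬sΨ (closed Φ Ψ oΦ sΦ (proj₂ (Equivalence.to (below⇔ Φ) Φ∈)))

-- Lattice points in a box

boxSum : ∀ n → ℕ → ((Fin n → ℕ) → ℕ) → ℕ
boxSum zero    k f = f (λ ())
boxSum (suc n) k f = sum (L.map (λ v → boxSum n k (f ∘ consF (suc v))) (upTo k))

countPts≡boxSum : ∀ n k p → countPts n k p ≡ boxSum n k (λ a → if p a then 1 else 0)
countPts≡boxSum zero    k p = refl
countPts≡boxSum (suc n) k p = cong sum (LP.map-cong (λ v → countPts≡boxSum n k _) (upTo k))

InBox : ∀ {n} → ℕ → (Fin n → ℕ) → Set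
InBox k a = ∀ i → 1 ≤ a i × a i ≤ k

map-cong-∈ : ∀ {A B : Set} {f g : A → B} (xs : List A) → (∀ x → x ∈ xs → f x ≡ g x) → L.map f xs ≡ L.map g xs
map-cong-∈ xs f≡g = LP.map-cong-local (All.tabulate (f≡g _))

boxSum-cong : ∀ n k {f g : (Fin n → ℕ) → ℕ} → (∀ a → InBox k a → f a ≡ g a) → boxSum n k f ≡ boxSum n k g
boxSum-cong zero    k f≡g = f≡g _ (λ ())
boxSum-cong (suc n) k f≡g = cong sum (map-cong-∈ (upTo k) λ v v∈ →
  boxSum-cong n k λ a a∈ → f≡g _ λ { F.zero → s≤s z≤n , ∈-upTo⁻ v∈ ; (F.suc i) → a∈ i })

sum-map-+ : ∀ {A : Set} (f g : A → ℕ) xs →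
            sum (L.map (λ x → f x + g x) xs) ≡ sum (L.map f xs) + sum (L.map g xs)
sum-map-+ f g []       = refl
sum-map-+ f g (x ∷ xs) = trans (cong (f x + g x +_) (sum-map-+ f g xs)) (interchange +-commutativeSemigroup (f x) (g x) _ _)

sum-map-* : ∀ {A : Set} c (f : A → ℕ) xs → sum (L.map (λ x → c * f x) xs) ≡ c * sum (L.map f xs)
sum-map-* c f []       = sym (*-zeroʳ c)
sum-map-* c f (x ∷ xs) = trans (cong (c * f x +_) (sum-map-* c f xs)) (sym (*-distribˡ-+ c (f x) _))

sum-swap : ∀ {A B : Set} (G : A → B → ℕ) xs ys →
           sum (L.map (λ x → sum (L.map (G x) ys)) xs) ≡ sum (L.map (λ y → sum (L.map (λ x → G x y) xs)) ys)
sum-swap G []       ys = sym (sum-zero (λ _ → 0) ys (λ _ _ → refl))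
sum-swap G (x ∷ xs) ys = trans (cong (sum (L.map (G x) ys) +_) (sum-swap G xs ys))
                               (sym (sum-map-+ (G x) (λ y → sum (L.map (λ x → G x y) xs)) ys))

boxSum-sum : ∀ {A : Set} n k (F : A → (Fin n → ℕ) → ℕ) xs →
             boxSum n k (λ a → sum (L.map (λ x → F x a) xs)) ≡ sum (L.map (λ x → boxSum n k (F x)) xs)
boxSum-sum zero    k F xs = refl
boxSum-sum (suc n) k F xs = trans
  (cong sum (LP.map-cong (λ v → boxSum-sum n k (λ x → F x ∘ consF (suc v)) xs) (upTo k)))
  (sum-swap (λ v x → boxSum n k (F x ∘ consF (suc v))) (upTo k) xs)

boxSum-* : ∀ n k c (f : (Fin n → ℕ) → ℕ) → boxSum n k (λ a → c * f a) ≡ c * boxSum n k f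
boxSum-* zero    k c f = refl
boxSum-* (suc n) k c f = trans (cong sum (LP.map-cong (λ v → boxSum-* n k c _) (upTo k))) (sum-map-* c _ (upTo k))

sum-upTo-suc : ∀ (f : ℕ → ℕ) v → sum (L.map f (upTo (suc v))) ≡ sum (L.map f (upTo v)) + f v
sum-upTo-suc f v = begin
  sum (L.map f (upTo (suc v)))                ≡⟨ cong (sum ∘ L.map f) (LP.upTo-∷ʳ v) ⟨
  sum (L.map f (upTo v L.∷ʳ v))               ≡⟨ cong sum (LP.map-++ f (upTo v) (v ∷ [])) ⟩
  sum (L.map f (upTo v) L.++ f v ∷ [])        ≡⟨ sum-++ (L.map f (upTo v)) (f v ∷ []) ⟩
  sum (L.map f (upTo v)) + (f v + 0)          ≡⟨ cong (sum (L.map f (upTo v)) +_) (+-identityʳ (f v)) ⟩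
  sum (L.map f (upTo v)) + f v                ∎
  where open ≡-Reasoning

hockey-stick : ∀ v c r → c ≤ r → sum (L.map (λ u → (u + c) C r) (upTo v)) ≡ (v + c) C suc r
hockey-stick zero    c r c≤r = sym (k>n⇒nCk≡0 (s≤s c≤r))
hockey-stick (suc v) c r c≤r = begin
  sum (L.map (λ u → (u + c) C r) (upTo (suc v)))          ≡⟨ sum-upTo-suc (λ u → (u + c) C r) v ⟩
  sum (L.map (λ u → (u + c) C r) (upTo v)) + (v + c) C r  ≡⟨ cong (_+ (v + c) C r) (hockey-stick v c r c≤r) ⟩
  (v + c) C suc r + (v + c) C r                           ≡⟨ +-comm ((v + c) C suc r) _ ⟩
  (v + c) C r + (v + c) C suc r                           ≡⟨ nCk+nC[k+1]≡[n+1]C[k+1] (v + c) r ⟩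
  suc (v + c) C suc r                                     ∎
  where open ≡-Reasoning

sum-upTo-restrict : ∀ k v (g : ℕ → ℕ) → v ≤ k →
                    sum (L.map (λ u → indicator (suc u ≤? v) * g u) (upTo k)) ≡ sum (L.map g (upTo v))
sum-upTo-restrict zero    .zero g z≤n = refl
sum-upTo-restrict (suc k) v     g v≤k+1 with m≤n⇒m<n∨m≡n v≤k+1
... | inj₁ v≤k = begin
  sum (L.map (λ u → indicator (suc u ≤? v) * g u) (upTo (suc k)))
    ≡⟨ sum-upTo-suc (λ u → indicator (suc u ≤? v) * g u) k ⟩
  sum (L.map (λ u → indicator (suc u ≤? v) * g u) (upTo k)) + indicator (suc k ≤? v) * g k
    ≡⟨ cong₂ (λ s i → s + i * g k) (sum-upTo-restrict k v g (≤-pred v≤k))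
                                   (indicator-no (suc k ≤? v) (<⇒≱ v≤k)) ⟩
  sum (L.map g (upTo v)) + 0
    ≡⟨ +-identityʳ _ ⟩
  sum (L.map g (upTo v)) ∎
  where open ≡-Reasoning
... | inj₂ refl = cong sum (map-cong-∈ (upTo (suc k)) λ u u∈ →
  trans (cong (_* g u) (indicator-yes (suc u ≤? suc k) (∈-upTo⁻ u∈))) (+-identityʳ (g u)))

Step : Bool → ℕ → ℕ → Set
Step true  x y = x < y
Step false x y = x ≤ y

step? : ∀ s x y → Dec (Step s x y)
step? true  x y = x <? y
step? false x y = x ≤? y

Descends : ∀ {n} → Vec Bool n → (Fin (suc n) → ℕ) → Set
Descends []       b = ⊤
Descends (s ∷ st) b = Step s (b (F.suc F.zero)) (b F.zero) × Descends st (b ∘ F.suc)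

descends? : ∀ {n} (st : Vec Bool n) b → Dec (Descends st b)
descends? []       b = yes tt
descends? (s ∷ st) b = step? s _ _ ×-dec descends? st _

weakSteps : ∀ {n} → Vec Bool n → ℕ
weakSteps []           = 0
weakSteps (true ∷ st)  = weakSteps st
weakSteps (false ∷ st) = suc (weakSteps st)

weakSteps≤ : ∀ {n} (st : Vec Bool n) → weakSteps st ≤ n
weakSteps≤ []           = z≤n
weakSteps≤ (true ∷ st)  = m≤n⇒m≤1+n (weakSteps≤ st)
weakSteps≤ (false ∷ st) = s≤s (weakSteps≤ st)

indicator-× : ∀ {P Q : Set} (p : Dec P) (q : Dec Q) → indicator (p ×-dec q) ≡ indicator p * indicator q
indicator-× (yes _) (yes _) = refl
indicator-× (yes _) (no _)  = refl
indicator-× (no _)  _       = refl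

-- After an entry u + 1, a step of type s allows next entries up to stepBound s u.
stepBound : Bool → ℕ → ℕ
stepBound true  u = u
stepBound false u = suc u

step⇔≤stepBound : ∀ s x u → indicator (step? s x (suc u)) ≡ indicator (x ≤? stepBound s u)
step⇔≤stepBound true  x u = indicator-cong (x <? suc u) (x ≤? u) ≤-pred s≤s
step⇔≤stepBound false x u = refl

-- Chains in [k] starting at most v: choose the first entry u + 1 ≤ v, then recurse with the
-- bound that the first step imposes, and sum with the hockey-stick identity.
boxSum-descends : ∀ n (st : Vec Bool n) k v → v ≤ k →
  boxSum (suc n) k (λ b → indicator (b F.zero ≤? v) * indicator (descends? st b)) ≡ (v + weakSteps st) C suc n
boxSum-descends zero []  k v v≤k = begin
  sum (L.map (λ u → indicator (suc u ≤? v) * 1) (upTo k)) ≡⟨ sum-upTo-restrict k v (λ _ → 1) v≤k ⟩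
  sum (L.map (λ _ → 1) (upTo v))                          ≡⟨ sum-ones v ⟩
  v                                                        ≡⟨ nC1≡n v ⟨
  v C 1                                                    ≡⟨ cong (_C 1) (+-identityʳ v) ⟨
  (v + 0) C 1                                              ∎
  where
  open ≡-Reasoning
  sum-ones : ∀ v → sum (L.map (λ _ → 1) (upTo v)) ≡ v
  sum-ones zero    = refl
  sum-ones (suc v) = trans (sum-upTo-suc (λ _ → 1) v) (trans (cong (_+ 1) (sum-ones v)) (+-comm v 1))
boxSum-descends (suc n) (s ∷ st) k v v≤k = begin
  sum (L.map (λ u → boxSum (suc n) k (λ b → indicator (suc u ≤? v) * indicator (descends? (s ∷ st) (consF (suc u) b)))) (upTo k))
    ≡⟨ cong sum (LP.map-cong (λ u → trans (boxSum-cong (suc n) k (λ b _ → cong (indicator (suc u ≤? v) *_) (peel u b)))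
                                          (boxSum-* (suc n) k (indicator (suc u ≤? v)) (below u))) (upTo k)) ⟩
  sum (L.map (λ u → indicator (suc u ≤? v) * rest u) (upTo k))
    ≡⟨ sum-upTo-restrict k v rest v≤k ⟩
  sum (L.map rest (upTo v))
    ≡⟨ cong sum (map-cong-∈ (upTo v) (λ u u∈ → boxSum-descends n st k (stepBound s u) (bound≤k s (<-≤-trans (∈-upTo⁻ u∈) v≤k)))) ⟩
  sum (L.map (λ u → (stepBound s u + weakSteps st) C suc n) (upTo v))
    ≡⟨ hockey s ⟩
  (v + weakSteps (s ∷ st)) C suc (suc n) ∎
  where
  open ≡-Reasoning
  below : ℕ → (Fin (suc n) → ℕ) → ℕ
  below u b = indicator (b F.zero ≤? stepBound s u) * indicator (descends? st b)
  rest : ℕ → ℕ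
  rest u = boxSum (suc n) k (below u)
  peel : ∀ u b → indicator (descends? (s ∷ st) (consF (suc u) b)) ≡ below u b
  peel u b = trans (indicator-× (step? s (b F.zero) (suc u)) (descends? st b))
                   (cong (_* indicator (descends? st b)) (step⇔≤stepBound s (b F.zero) u))
  bound≤k : ∀ s {u} → u < k → stepBound s u ≤ k
  bound≤k true  u<k = <⇒≤ u<k
  bound≤k false u<k = u<k
  hockey : ∀ s → sum (L.map (λ u → (stepBound s u + weakSteps st) C suc n) (upTo v)) ≡ (v + weakSteps (s ∷ st)) C suc (suc n)
  hockey true  = hockey-stick v (weakSteps st) (suc n) (m≤n⇒m≤1+n (weakSteps≤ st))
  hockey false = trans (cong sum (LP.map-cong (λ u → cong (_C suc n) (sym (+-suc u (weakSteps st)))) (upTo v)))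
                       (hockey-stick v (suc (weakSteps st)) (suc n) (s≤s (weakSteps≤ st)))

Extensional : ∀ {n} → ((Fin n → ℕ) → ℕ) → Set
Extensional f = ∀ a b → (∀ i → a i ≡ b i) → f a ≡ f b

boxPoints : ∀ n → ℕ → List (Vec ℕ n)
boxPoints zero    k = [] ∷ []
boxPoints (suc n) k = concatMap (λ v → L.map (suc v ∷_) (boxPoints n k)) (upTo k)

sum-concatMap : ∀ {A B : Set} (g : B → ℕ) (h : A → List B) xs →
                sum (L.map g (concatMap h xs)) ≡ sum (L.map (λ x → sum (L.map g (h x))) xs)
sum-concatMap g h []       = refl
sum-concatMap g h (x ∷ xs) = begin
  sum (L.map g (h x L.++ concatMap h xs))                   ≡⟨ cong sum (LP.map-++ g (h x) _) ⟩
  sum (L.map g (h x) L.++ L.map g (concatMap h xs))         ≡⟨ sum-++ (L.map g (h x)) _ ⟩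
  sum (L.map g (h x)) + sum (L.map g (concatMap h xs))      ≡⟨ cong (sum (L.map g (h x)) +_) (sum-concatMap g h xs) ⟩
  sum (L.map g (h x)) + sum (L.map (λ x → sum (L.map g (h x))) xs) ∎
  where open ≡-Reasoning

boxSum≡sum-boxPoints : ∀ n k (f : (Fin n → ℕ) → ℕ) → Extensional f →
                       boxSum n k f ≡ sum (L.map (f ∘ lookup) (boxPoints n k))
boxSum≡sum-boxPoints zero    k f ext = trans (ext _ _ (λ ())) (sym (+-identityʳ _))
boxSum≡sum-boxPoints (suc n) k f ext = begin
  sum (L.map (λ v → boxSum n k (f ∘ consF (suc v))) (upTo k))
    ≡⟨ cong sum (LP.map-cong (λ v → trans (boxSum≡sum-boxPoints n k _ (λ a b a≗b → ext _ _ (cons-cong a≗b)))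
                                          (cong sum (trans (LP.map-cong (λ w → ext _ _ lookup-cons) (boxPoints n k))
                                                           (LP.map-∘ (boxPoints n k))))) (upTo k)) ⟩
  sum (L.map (λ v → sum (L.map (f ∘ lookup) (L.map (suc v ∷_) (boxPoints n k)))) (upTo k))
    ≡⟨ sum-concatMap (f ∘ lookup) (λ v → L.map (suc v ∷_) (boxPoints n k)) (upTo k) ⟨
  sum (L.map (f ∘ lookup) (boxPoints (suc n) k)) ∎
  where
  open ≡-Reasoning
  cons-cong : ∀ {v} {a b : Fin n → ℕ} → (∀ i → a i ≡ b i) → ∀ i → consF v a i ≡ consF v b i
  cons-cong a≗b F.zero    = refl
  cons-cong a≗b (F.suc i) = a≗b i
  lookup-cons : ∀ {v} {w : Vec ℕ n} i → consF v (lookup w) i ≡ lookup (v ∷ w) i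
  lookup-cons F.zero    = refl
  lookup-cons (F.suc i) = refl

∈-boxPoints⁺ : ∀ {n k} (w : Vec ℕ n) → InBox k (lookup w) → w ∈ boxPoints n k
∈-boxPoints⁺ []                  _    = here refl
∈-boxPoints⁺ (zero ∷ w)          w∈ with () ← proj₁ (w∈ F.zero)
∈-boxPoints⁺ {suc n} {k} (suc v ∷ w) w∈ =
  ∈-concatMap⁺ (λ v → L.map (suc v ∷_) (boxPoints n k)) {xs = upTo k}
    (Any.map (λ { refl → ∈-map⁺ (suc v ∷_) (∈-boxPoints⁺ w (w∈ ∘ F.suc)) }) (∈-upTo⁺ (proj₂ (w∈ F.zero))))

∈-boxPoints⁻ : ∀ {n k} (w : Vec ℕ n) → w ∈ boxPoints n k → InBox k (lookup w)
∈-boxPoints⁻ {suc n} {k} w w∈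
  with (v , v∈ , w∈′) ← find (∈-concatMap⁻ (λ v → L.map (suc v ∷_) (boxPoints n k)) {xs = upTo k} w∈)
  with (w′ , w′∈ , refl) ← ∈-map⁻ (suc v ∷_) w∈′
  = λ { F.zero → s≤s z≤n , ∈-upTo⁻ v∈ ; (F.suc i) → ∈-boxPoints⁻ w′ w′∈ i }

boxPoints-unique : ∀ n k → Unique (boxPoints n k)
boxPoints-unique zero    k = All.[] AP.∷ AP.[]
boxPoints-unique (suc n) k = concatMap-unique (upTo k) (UP.upTo⁺ k)
  where
  block : ℕ → List (Vec ℕ (suc n))
  block v = L.map (suc v ∷_) (boxPoints n k)
  head∈ : ∀ vs {w} → w ∈ concatMap block vs → ∃[ v ] (v ∈ vs × head w ≡ suc v)
  head∈ vs w∈ with (v , v∈ , w∈′) ← find (∈-concatMap⁻ block {xs = vs} w∈)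
              with (_ , _ , refl) ← ∈-map⁻ (suc v ∷_) w∈′ = v , v∈ , refl
  concatMap-unique : ∀ vs → Unique vs → Unique (concatMap block vs)
  concatMap-unique []       _                = AP.[]
  concatMap-unique (v ∷ vs) (v∉vs AP.∷ uvs) = UP.++⁺
    (UP.map⁺ (λ e → proj₂ (VP.∷-injective e)) (boxPoints-unique n k))
    (concatMap-unique vs uvs)
    (λ (w∈block , w∈rest) → disjoint w∈block w∈rest)
    where
    disjoint : ∀ {w} → w ∈ block v → w ∈ concatMap block vs → ⊥
    disjoint w∈block w∈rest with (_ , _ , refl) ← ∈-map⁻ (suc v ∷_) w∈block
                            with (v′ , v′∈ , hd≡) ← head∈ vs w∈rest
      = All.lookup v∉vs v′∈ (suc-injective hd≡)

boxSum-permute : ∀ {n} k (ρ ρ⁻¹ : Fin n → Fin n) → (∀ p → ρ (ρ⁻¹ p) ≡ p) → (∀ i → ρ⁻¹ (ρ i) ≡ i) →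
                 (f : (Fin n → ℕ) → ℕ) → Extensional f → boxSum n k f ≡ boxSum n k (λ a → f (a ∘ ρ))
boxSum-permute {n} k ρ ρ⁻¹ ρρ⁻¹ ρ⁻¹ρ f ext = begin
  boxSum n k f                                          ≡⟨ boxSum≡sum-boxPoints n k f ext ⟩
  sum (L.map (f ∘ lookup) points)                       ≡⟨ sum-↭ (PermP.map⁺ (f ∘ lookup) points↭) ⟩
  sum (L.map (f ∘ lookup) (L.map (permute ρ) points))   ≡⟨ cong sum (LP.map-∘ points) ⟨
  sum (L.map (f ∘ lookup ∘ permute ρ) points)           ≡⟨ cong sum (LP.map-cong (λ w → ext _ _ (lookup-permute ρ w)) points) ⟩
  sum (L.map (λ w → f (lookup w ∘ ρ)) points)           ≡⟨ boxSum≡sum-boxPoints n k _ (λ a b a≗b → ext _ _ (a≗b ∘ ρ)) ⟨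
  boxSum n k (λ a → f (a ∘ ρ))                          ∎
  where
  open ≡-Reasoning
  points : List (Vec ℕ n)
  points = boxPoints n k
  permute : (Fin n → Fin n) → Vec ℕ n → Vec ℕ n
  permute σ w = tabulate (lookup w ∘ σ)
  lookup-permute : ∀ σ w i → lookup (permute σ w) i ≡ lookup w (σ i)
  lookup-permute σ w = VP.lookup∘tabulate (lookup w ∘ σ)
  permute-inBox : ∀ σ w → InBox k (lookup w) → InBox k (lookup (permute σ w))
  permute-inBox σ w w∈ i = subst (λ x → 1 ≤ x × x ≤ k) (sym (lookup-permute σ w i)) (w∈ (σ i))
  permute-inverse : ∀ w → permute ρ (permute ρ⁻¹ w) ≡ w
  permute-inverse w = lookup-ext λ i →
    trans (lookup-permute ρ (permute ρ⁻¹ w) i) (trans (lookup-permute ρ⁻¹ w (ρ i)) (cong (lookup w) (ρ⁻¹ρ i)))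
  permute-injective : ∀ {w w′} → permute ρ w ≡ permute ρ w′ → w ≡ w′
  permute-injective {w} {w′} e = lookup-ext λ p → begin
    lookup w p                     ≡⟨ cong (lookup w) (ρρ⁻¹ p) ⟨
    lookup w (ρ (ρ⁻¹ p))           ≡⟨ lookup-permute ρ w (ρ⁻¹ p) ⟨
    lookup (permute ρ w) (ρ⁻¹ p)   ≡⟨ cong (λ z → lookup z (ρ⁻¹ p)) e ⟩
    lookup (permute ρ w′) (ρ⁻¹ p)  ≡⟨ lookup-permute ρ w′ (ρ⁻¹ p) ⟩
    lookup w′ (ρ (ρ⁻¹ p))          ≡⟨ cong (lookup w′) (ρρ⁻¹ p) ⟩
    lookup w′ p                    ∎
  points↭ : points ↭ L.map (permute ρ) points
  points↭ = ∼bag⇒↭ (unique∧set⇒bag (boxPoints-unique n k) (UP.map⁺ permute-injective (boxPoints-unique n k))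
    λ {w} → mk⇔ (λ w∈ → subst (_∈ L.map (permute ρ) points) (permute-inverse w)
                           (∈-map⁺ (permute ρ) (∈-boxPoints⁺ (permute ρ⁻¹ w) (permute-inBox ρ⁻¹ w (∈-boxPoints⁻ w w∈)))))
                (λ w∈ → let (w′ , w′∈ , w≡) = ∈-map⁻ (permute ρ) w∈
                        in subst (_∈ points) (sym w≡) (∈-boxPoints⁺ (permute ρ w′) (permute-inBox ρ w′ (∈-boxPoints⁻ w′ w′∈)))))

-- Patterns of points and the cone of an interval

ai≤Σa : ∀ {n} (a : Fin n → ℕ) i → a i ≤ ΣFin n a
ai≤Σa a F.zero    = m≤m+n _ _
ai≤Σa a (F.suc i) = ≤-trans (ai≤Σa (a ∘ F.suc) i) (m≤n+m _ _)

module PatternOf {n} (a : Fin n → ℕ) where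

  occurs? : ∀ v → Dec (∃[ i ] a i ≡ v)
  occurs? v = FP.any? (λ i → a i ≟ v)

  valuesBelow : ℕ → ℕ
  valuesBelow zero    = 0
  valuesBelow (suc m) = valuesBelow m + indicator (occurs? m)

  valuesBelow-mono : ∀ {m m′} → m ≤ m′ → valuesBelow m ≤ valuesBelow m′
  valuesBelow-mono {m′ = zero}   z≤n = ≤-refl
  valuesBelow-mono {m′ = suc m′} m≤m′+1 with m≤n⇒m<n∨m≡n m≤m′+1
  ... | inj₁ m≤m′ = ≤-trans (valuesBelow-mono (≤-pred m≤m′)) (m≤m+n _ _)
  ... | inj₂ refl = ≤-refl

  valuesBelow-occurs : ∀ i → valuesBelow (suc (a i)) ≡ suc (valuesBelow (a i))
  valuesBelow-occurs i = trans (cong (valuesBelow (a i) +_) (indicator-yes (occurs? (a i)) (i , refl)))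
                               (+-comm _ 1)

  valuesBelow-strict : ∀ i {v} → a i < v → valuesBelow (a i) < valuesBelow v
  valuesBelow-strict i {v} lt = subst (_≤ valuesBelow v) (valuesBelow-occurs i) (valuesBelow-mono lt)

  valuesBelow-attained : ∀ m t → t < valuesBelow m → ∃[ i ] valuesBelow (a i) ≡ t
  valuesBelow-attained (suc m) t lt with t <? valuesBelow m
  ... | yes t< = valuesBelow-attained m t t<
  ... | no t≮ with occurs? m
  ...   | yes (i , ai≡m) = i , trans (cong valuesBelow ai≡m)
                                     (≤-antisym (≮⇒≥ t≮) (≤-pred (subst (t <_) (+-comm (valuesBelow m) 1) lt)))
  ...   | no _           = ⊥-elim (t≮ (subst (t <_) (+-identityʳ _) lt))

  valuesBelow<len : ∀ i → valuesBelow (a i) < valuesBelow (suc (ΣFin n a))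
  valuesBelow<len i = valuesBelow-strict i (s≤s (ai≤Σa a i))

  Δ : OSP n
  Δ = valuesBelow (suc (ΣFin n a)) , tabulate (λ i → fromℕ< (valuesBelow<len i))

  blkℕ-Δ : ∀ i → blkℕ Δ i ≡ valuesBelow (a i)
  blkℕ-Δ i = trans (blkℕ-tabulate _ i) (FP.toℕ-fromℕ< (valuesBelow<len i))

  Δ-isOSP : IsOSP Δ
  Δ-isOSP = inhabited⇒IsOSP Δ λ v v< →
    let (i , e) = valuesBelow-attained _ v v< in i , trans (blkℕ-Δ i) e

  Δ-hasPattern : HasPattern a Δ
  Δ-hasPattern i j = sameBlock , λ lt → ≰⇒> λ aj≤ai → <-irrefl refl
    (<-≤-trans (subst₂ _<_ (blkℕ-Δ i) (blkℕ-Δ j) lt) (valuesBelow-mono aj≤ai))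
    where
    sameBlock : blk Δ i ≡ blk Δ j → a i ≡ a j
    sameBlock e with <-cmp (a i) (a j)
    ... | tri< ai<aj _ _ = ⊥-elim (<-irrefl same (valuesBelow-strict i ai<aj))
      where
      same : valuesBelow (a i) ≡ valuesBelow (a j)
      same = trans (sym (blkℕ-Δ i)) (trans (cong toℕ e) (blkℕ-Δ j))
    ... | tri≈ _ ai≡aj _ = ai≡aj
    ... | tri> _ _ aj<ai = ⊥-elim (<-irrefl same (valuesBelow-strict j aj<ai))
      where
      same : valuesBelow (a j) ≡ valuesBelow (a i)
      same = trans (sym (blkℕ-Δ j)) (trans (cong toℕ (sym e)) (blkℕ-Δ i))

-- a lies in the half-open cone of the interval [Θ, finest Θ]: weakly increasing along the
-- finest refinement of Θ and strictly increasing from one block of Θ to the next.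
Compatible : ∀ {n} → OSP n → (Fin n → ℕ) → Set
Compatible Θ a = ∀ i j → (blkℕ Θ i < blkℕ Θ j → a i < a j) × (blkℕ Θ i ≡ blkℕ Θ j → toℕ i ≤ toℕ j → a i ≤ a j)

compatible? : ∀ {n} (Θ : OSP n) a → Dec (Compatible Θ a)
compatible? Θ a = FP.all? λ i → FP.all? λ j →
  ((blkℕ Θ i <? blkℕ Θ j) →-dec (a i <? a j)) ×-dec ((blkℕ Θ i ≟ blkℕ Θ j) →-dec ((toℕ i ≤? toℕ j) →-dec (a i ≤? a j)))

compatible-extensional : ∀ {n} (Θ : OSP n) → Extensional (indicator ∘ compatible? Θ)
compatible-extensional Θ a b a≗b = indicator-cong (compatible? Θ a) (compatible? Θ b) (transport a≗b) (transport (sym ∘ a≗b))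
  where
  transport : ∀ {a b} → (∀ i → a i ≡ b i) → Compatible Θ a → Compatible Θ b
  transport a≗b c i j = (λ lt → subst₂ _<_ (a≗b i) (a≗b j) (proj₁ (c i j) lt))
                      , (λ e le → subst₂ _≤_ (a≗b i) (a≗b j) (proj₂ (c i j) e le))

module _ {n} {a : Fin n → ℕ} {Φ : OSP n} (pat : HasPattern a Φ) where

  compatible⇒⊑ : ∀ {Θ} → Compatible Θ a → Θ ⊑ Φ
  compatible⇒⊑ c = record
    { coarsens      = λ i j Φi≤Φj → ≮⇒≥ λ Θj<Θi → <-irrefl refl
                        (<-≤-trans (pattern-reflects-< {Φ = Φ} pat j i (proj₁ (c j i) Θj<Θi)) Φi≤Φj)
    ; splitsInOrder = λ i j Θi≡Θj Φi<Φj → ≰⇒> λ j≤i → <-irrefl refl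
                        (<-≤-trans Φi<Φj (pattern-reflects-≤ {Φ = Φ} pat j i (proj₂ (c j i) (sym Θi≡Θj) j≤i))) }

  ⊑⇒compatible : ∀ {Θ} → Θ ⊑ Φ → Compatible Θ a
  ⊑⇒compatible Θ⊑Φ i j =
    (λ Θi<Θj → ≰⇒> λ aj≤ai → <-irrefl refl (<-≤-trans Θi<Θj (coarsens Θ⊑Φ j i (pattern-reflects-≤ {Φ = Φ} pat j i aj≤ai)))) ,
    (λ Θi≡Θj i≤j → ≮⇒≥ λ aj<ai → <-irrefl refl (<-≤-trans
       (splitsInOrder Θ⊑Φ j i (sym Θi≡Θj) (pattern-reflects-< {Φ = Φ} pat j i aj<ai)) i≤j))

Decreasing : ∀ {m} → (Fin m → ℕ) → Set
Decreasing θ = ∀ p q → toℕ p ≤ toℕ q → θ q ≤ θ p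

UnitSteps : ∀ {m} → (Fin m → ℕ) → Set
UnitSteps θ = ∀ p q → toℕ q ≡ suc (toℕ p) → θ p ≤ suc (θ q)

FitsDecreasing : ∀ {m} → (Fin m → ℕ) → (Fin m → ℕ) → Set
FitsDecreasing θ b = ∀ p q → (θ p < θ q → b p < b q) × (θ p ≡ θ q → toℕ q ≤ toℕ p → b p ≤ b q)

steps : ∀ {n} → (Fin (suc n) → ℕ) → Vec Bool n
steps {zero}  θ = []
steps {suc n} θ = does (θ (F.suc F.zero) <? θ F.zero) ∷ steps (θ ∘ F.suc)

module _ {n} {θ : Fin (suc (suc n)) → ℕ} (dec : Decreasing θ) where

  Decreasing-tail : Decreasing (θ ∘ F.suc)
  Decreasing-tail p q le = dec (F.suc p) (F.suc q) (s≤s le)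

  θ1≡θ0 : ¬ θ (F.suc F.zero) < θ F.zero → θ (F.suc F.zero) ≡ θ F.zero
  θ1≡θ0 θ1≮θ0 = ≤-antisym (dec F.zero (F.suc F.zero) z≤n) (≮⇒≥ θ1≮θ0)

fits⇒descends : ∀ {n} {θ b : Fin (suc n) → ℕ} → Decreasing θ → FitsDecreasing θ b → Descends (steps θ) b
fits⇒descends {zero}          dec fits = tt
fits⇒descends {suc n} {θ} {b} dec fits = first (θ (F.suc F.zero) <? θ F.zero) ,
  fits⇒descends (Decreasing-tail dec) fits-tail
  where
  fits-tail : FitsDecreasing (θ ∘ F.suc) (b ∘ F.suc)
  fits-tail p q = proj₁ (fits (F.suc p) (F.suc q)) , λ e le → proj₂ (fits (F.suc p) (F.suc q)) e (s≤s le)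
  first : (d : Dec (θ (F.suc F.zero) < θ F.zero)) → Step (does d) (b (F.suc F.zero)) (b F.zero)
  first (yes θ1<θ0) = proj₁ (fits (F.suc F.zero) F.zero) θ1<θ0
  first (no θ1≮θ0)  = proj₂ (fits (F.suc F.zero) F.zero) (θ1≡θ0 dec θ1≮θ0) z≤n

descends⇒fits : ∀ {n} {θ b : Fin (suc n) → ℕ} → Decreasing θ → Descends (steps θ) b → FitsDecreasing θ b
descends⇒fits {zero} dec _ F.zero F.zero = (λ lt → ⊥-elim (<-irrefl refl lt)) , λ _ _ → ≤-refl
descends⇒fits {suc n} {θ} {b} dec (first , rest) = fits
  where
  fits-tail : FitsDecreasing (θ ∘ F.suc) (b ∘ F.suc)
  fits-tail = descends⇒fits (Decreasing-tail dec) rest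
  tail≤b1 : ∀ p → b (F.suc p) ≤ b (F.suc F.zero)
  tail≤b1 p with m≤n⇒m<n∨m≡n (dec (F.suc F.zero) (F.suc p) (s≤s z≤n))
  ... | inj₁ θp<θ1 = <⇒≤ (proj₁ (fits-tail p F.zero) θp<θ1)
  ... | inj₂ θp≡θ1 = proj₂ (fits-tail p F.zero) θp≡θ1 z≤n
  versus-b0 : ∀ p → (d : Dec (θ (F.suc F.zero) < θ F.zero)) → Step (does d) (b (F.suc F.zero)) (b F.zero) →
              (θ (F.suc p) < θ F.zero → b (F.suc p) < b F.zero) × (θ (F.suc p) ≡ θ F.zero → b (F.suc p) ≤ b F.zero)
  versus-b0 p (yes _) b1<b0 = (λ _ → ≤-<-trans (tail≤b1 p) b1<b0) , λ _ → <⇒≤ (≤-<-trans (tail≤b1 p) b1<b0)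
  versus-b0 p (no θ1≮θ0) b1≤b0 =
    (λ θp<θ0 → <-≤-trans (proj₁ (fits-tail p F.zero) (subst (θ (F.suc p) <_) (sym (θ1≡θ0 dec θ1≮θ0)) θp<θ0)) b1≤b0) ,
    (λ _ → ≤-trans (tail≤b1 p) b1≤b0)
  fits : FitsDecreasing θ b
  fits F.zero    F.zero    = (λ lt → ⊥-elim (<-irrefl refl lt)) , λ _ _ → ≤-refl
  fits F.zero    (F.suc q) = (λ θ0<θq → ⊥-elim (<-irrefl refl (<-≤-trans θ0<θq (dec F.zero (F.suc q) z≤n)))) , λ _ ()
  fits (F.suc p) F.zero    = let (lt , le) = versus-b0 p (θ (F.suc F.zero) <? θ F.zero) first in lt , λ e _ → le e
  fits (F.suc p) (F.suc q) = proj₁ (fits-tail p q) , λ e le → proj₂ (fits-tail p q) e (≤-pred le)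

strictSteps : ∀ {n} → Vec Bool n → ℕ
strictSteps []           = 0
strictSteps (true ∷ st)  = suc (strictSteps st)
strictSteps (false ∷ st) = strictSteps st

weakSteps+strictSteps : ∀ {n} (st : Vec Bool n) → weakSteps st + strictSteps st ≡ n
weakSteps+strictSteps []           = refl
weakSteps+strictSteps (true ∷ st)  = trans (+-suc (weakSteps st) _) (cong suc (weakSteps+strictSteps st))
weakSteps+strictSteps (false ∷ st) = cong suc (weakSteps+strictSteps st)

-- The labels drop by exactly one at each strict step, so strict steps count the total drop.
strictSteps-steps : ∀ {n} (θ : Fin (suc n) → ℕ) → Decreasing θ → UnitSteps θ →
                    strictSteps (steps θ) + θ (F.fromℕ n) ≡ θ F.zero
strictSteps-steps {zero}  θ dec unit = refl
strictSteps-steps {suc n} θ dec unit = first (θ (F.suc F.zero) <? θ F.zero)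
  where
  rest : strictSteps (steps (θ ∘ F.suc)) + θ (F.suc (F.fromℕ n)) ≡ θ (F.suc F.zero)
  rest = strictSteps-steps (θ ∘ F.suc) (Decreasing-tail dec) (λ p q e → unit (F.suc p) (F.suc q) (cong suc e))
  first : (d : Dec (θ (F.suc F.zero) < θ F.zero)) →
          strictSteps (does d ∷ steps (θ ∘ F.suc)) + θ (F.suc (F.fromℕ n)) ≡ θ F.zero
  first (yes θ1<θ0) = trans (cong suc rest) (≤-antisym θ1<θ0 (unit F.zero (F.suc F.zero) refl))
  first (no θ1≮θ0)  = trans rest (θ1≡θ0 dec θ1≮θ0)

boxSum-descends-all : ∀ n (st : Vec Bool n) k →
                      boxSum (suc n) k (indicator ∘ descends? st) ≡ (k + weakSteps st) C suc n
boxSum-descends-all n st k = trans (boxSum-cong (suc n) k λ b b∈ →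
  sym (trans (cong (_* indicator (descends? st b)) (indicator-yes (b F.zero ≤? k) (proj₂ (b∈ F.zero)))) (+-identityʳ _)))
  (boxSum-descends n st k k ≤-refl)

-- List the items in decreasing lexicographic order of (block, item); the block labels then
-- decrease along the list, dropping by at most one at each position.
module DecreasingLayout {n} (Θ : OSP (suc n)) (oΘ : IsOSP Θ) where
  open Finest Θ using (_≺_; ≺-trans; ≺-compare)
  open Ranking (Flip.trans _≺_ ≺-trans) (Flip.compare _≺_ ≺-compare) public
    using (rank; rank⁻¹; rank∘rank⁻¹; rank⁻¹∘rank)

  private module R = Ranking (Flip.trans _≺_ ≺-trans) (Flip.compare _≺_ ≺-compare)

  rank-antitone : ∀ {i j} → i ≺ j → toℕ (rank j) < toℕ (rank i)
  rank-antitone {i} {j} i≺j = subst₂ _<_ (sym (R.toℕ-rank j)) (sym (R.toℕ-rank i)) (R.rankℕ-strictMono i≺j)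

  ≺⇒later : ∀ {p q} → rank⁻¹ p ≺ rank⁻¹ q → toℕ q < toℕ p
  ≺⇒later {p} {q} lt = subst₂ _<_ (cong toℕ (rank∘rank⁻¹ q)) (cong toℕ (rank∘rank⁻¹ p)) (rank-antitone lt)

  θ : Fin (suc n) → ℕ
  θ p = blkℕ Θ (rank⁻¹ p)

  θ∘rank : ∀ i → θ (rank i) ≡ blkℕ Θ i
  θ∘rank i = cong (blkℕ Θ) (rank⁻¹∘rank i)

  θ-decreasing : Decreasing θ
  θ-decreasing p q p≤q = ≮⇒≥ λ θp<θq → <-irrefl refl (<-≤-trans (≺⇒later (inj₁ θp<θq)) p≤q)

  θ-unitSteps : UnitSteps θ
  θ-unitSteps p q q≡p+1 = ≮⇒≥ λ θq+1<θp →
    let (i , Θi≡) = block-inhabited oΘ (suc (θ q)) (<-trans θq+1<θp (blkℕ<len Θ (rank⁻¹ p)))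
    in between (rank i) (trans (θ∘rank i) Θi≡) θq+1<θp
    where
    between : ∀ r → θ r ≡ suc (θ q) → suc (θ q) < θ p → ⊥
    between r θr≡ θq+1<θp with ≤-<-connex (toℕ r) (toℕ p)
    ... | inj₁ r≤p = <-irrefl refl (<-≤-trans θq+1<θp (subst (θ p ≤_) θr≡ (θ-decreasing r p r≤p)))
    ... | inj₂ p<r = 1+n≰n (subst (_≤ θ q) θr≡ (θ-decreasing q r (subst (_≤ toℕ r) (sym q≡p+1) p<r)))

  θ-first : suc (θ F.zero) ≡ len Θ
  θ-first = ≤-antisym (blkℕ<len Θ (rank⁻¹ F.zero)) (bounded (len Θ) refl)
    where
    bounded : ∀ ℓ → ℓ ≡ len Θ → ℓ ≤ suc (θ F.zero)
    bounded zero    _ = z≤n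
    bounded (suc ℓ) e with block-inhabited oΘ ℓ (subst (ℓ <_) e ≤-refl)
    ... | i , Θi≡ℓ = s≤s (subst (_≤ θ F.zero) (trans (θ∘rank i) Θi≡ℓ) (θ-decreasing F.zero (rank i) z≤n))

  θ-last : θ (F.fromℕ n) ≡ 0
  θ-last with block-inhabited oΘ 0 (≤-<-trans z≤n (blkℕ<len Θ (rank⁻¹ F.zero)))
  ... | i , Θi≡0 = n≤0⇒n≡0 (subst (θ (F.fromℕ n) ≤_) (trans (θ∘rank i) Θi≡0)
                     (θ-decreasing (rank i) (F.fromℕ n) (subst (toℕ (rank i) ≤_) (sym (FP.toℕ-fromℕ n))
                                                                (≤-pred (FP.toℕ<n (rank i))))))

  compatible⇒fits : ∀ b → Compatible Θ (b ∘ rank) → FitsDecreasing θ b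
  compatible⇒fits b c p q =
    (λ θp<θq → subst₂ _<_ (cong b (rank∘rank⁻¹ p)) (cong b (rank∘rank⁻¹ q)) (proj₁ (c (rank⁻¹ p) (rank⁻¹ q)) θp<θq)) ,
    (λ θp≡θq q≤p → subst₂ _≤_ (cong b (rank∘rank⁻¹ p)) (cong b (rank∘rank⁻¹ q))
       (proj₂ (c (rank⁻¹ p) (rank⁻¹ q)) θp≡θq
         (≮⇒≥ λ q′<p′ → <-irrefl refl (<-≤-trans (≺⇒later (inj₂ (sym θp≡θq , q′<p′))) q≤p))))

  fits⇒compatible : ∀ b → FitsDecreasing θ b → Compatible Θ (b ∘ rank)
  fits⇒compatible b fits i j =
    (λ Θi<Θj → proj₁ (fits (rank i) (rank j)) (subst₂ _<_ (sym (θ∘rank i)) (sym (θ∘rank j)) Θi<Θj)) ,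
    (λ Θi≡Θj i≤j → proj₂ (fits (rank i) (rank j)) (trans (θ∘rank i) (trans Θi≡Θj (sym (θ∘rank j)))) (later Θi≡Θj i≤j))
    where
    later : blkℕ Θ i ≡ blkℕ Θ j → toℕ i ≤ toℕ j → toℕ (rank j) ≤ toℕ (rank i)
    later Θi≡Θj i≤j with m≤n⇒m<n∨m≡n i≤j
    ... | inj₁ i<j = <⇒≤ (rank-antitone (inj₂ (Θi≡Θj , i<j)))
    ... | inj₂ i≡j = ≤-reflexive (cong (toℕ ∘ rank) (sym (FP.toℕ-injective i≡j)))

boxSum-compatible : ∀ {n} (Θ : OSP (suc n)) → IsOSP Θ → ∀ k →
                    boxSum (suc n) k (indicator ∘ compatible? Θ) ≡ (k + suc n ∸ len Θ) C suc n
boxSum-compatible {n} Θ oΘ k = begin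
  boxSum (suc n) k (indicator ∘ compatible? Θ)
    ≡⟨ boxSum-permute k rank rank⁻¹ rank∘rank⁻¹ rank⁻¹∘rank (indicator ∘ compatible? Θ) (compatible-extensional Θ) ⟩
  boxSum (suc n) k (λ b → indicator (compatible? Θ (b ∘ rank)))
    ≡⟨ boxSum-cong (suc n) k (λ b _ → indicator-cong (compatible? Θ (b ∘ rank)) (descends? st b)
         (fits⇒descends θ-decreasing ∘ compatible⇒fits b) (fits⇒compatible b ∘ descends⇒fits θ-decreasing)) ⟩
  boxSum (suc n) k (indicator ∘ descends? st)
    ≡⟨ boxSum-descends-all n st k ⟩
  (k + weakSteps st) C suc n
    ≡⟨ cong (_C suc n) k+weak≡ ⟩
  (k + suc n ∸ len Θ) C suc n ∎
  where
  open ≡-Reasoning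
  open DecreasingLayout Θ oΘ
  st : Vec Bool n
  st = steps θ
  strict≡ : strictSteps st ≡ θ F.zero
  strict≡ = trans (sym (+-identityʳ _)) (trans (cong (strictSteps st +_) (sym θ-last))
                                               (strictSteps-steps θ θ-decreasing θ-unitSteps))
  k+weak≡ : k + weakSteps st ≡ k + suc n ∸ len Θ
  k+weak≡ = begin
    k + weakSteps st
      ≡⟨ cong (k +_) (m+n∸n≡m (weakSteps st) (strictSteps st)) ⟨
    k + (weakSteps st + strictSteps st ∸ strictSteps st)
      ≡⟨ cong (λ m → k + (m ∸ strictSteps st)) (weakSteps+strictSteps st) ⟩
    k + (n ∸ strictSteps st)
      ≡⟨ +-∸-assoc k (subst (strictSteps st ≤_) (weakSteps+strictSteps st) (m≤n+m _ _)) ⟨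
    k + n ∸ strictSteps st
      ≡⟨ cong (_∸ suc (strictSteps st)) (+-suc k n) ⟨
    k + suc n ∸ suc (strictSteps st)
      ≡⟨ cong (λ s → k + suc n ∸ s) (trans (cong suc strict≡) θ-first) ⟩
    k + suc n ∸ len Θ ∎

-- The h*-vector

ΣFin-cong : ∀ m {f g : Fin m → ℕ} → (∀ i → f i ≡ g i) → ΣFin m f ≡ ΣFin m g
ΣFin-cong zero    f≗g = refl
ΣFin-cong (suc m) f≗g = cong₂ _+_ (f≗g F.zero) (ΣFin-cong m (f≗g ∘ F.suc))

ΣFin-pick : ∀ m (G : ℕ → ℕ) ℓ → ℓ < m → ΣFin m (λ i → indicator (ℓ ≟ toℕ i) * G (toℕ i)) ≡ G ℓ
ΣFin-pick (suc m) G zero    _ = trans (cong₂ _+_ (+-identityʳ (G 0)) rest≡0) (+-identityʳ (G 0))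
  where
  ΣFin-zero : ∀ m → 0 ≡ ΣFin m (λ _ → 0)
  ΣFin-zero zero    = refl
  ΣFin-zero (suc m) = ΣFin-zero m
  rest≡0 : ΣFin m (λ i → indicator (zero ≟ suc (toℕ i)) * G (suc (toℕ i))) ≡ 0
  rest≡0 = trans (ΣFin-cong m (λ i → cong (_* G (suc (toℕ i))) (indicator-no (zero ≟ suc (toℕ i)) (λ ()))))
                 (sym (ΣFin-zero m))
ΣFin-pick (suc m) G (suc ℓ) ℓ<m = begin
  indicator (suc ℓ ≟ 0) * G 0 + ΣFin m (λ i → indicator (suc ℓ ≟ suc (toℕ i)) * G (suc (toℕ i)))
    ≡⟨ cong₂ _+_ (cong (_* G 0) (indicator-no (suc ℓ ≟ 0) (λ ())))
                 (ΣFin-cong m λ i → cong (_* G (suc (toℕ i)))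
                   (indicator-cong (suc ℓ ≟ suc (toℕ i)) (ℓ ≟ toℕ i) suc-injective (cong suc))) ⟩
  ΣFin m (λ i → indicator (ℓ ≟ toℕ i) * G (suc (toℕ i)))
    ≡⟨ ΣFin-pick m (G ∘ suc) ℓ (≤-pred ℓ<m) ⟩
  G (suc ℓ) ∎
  where open ≡-Reasoning

sum-ΣFin : ∀ {A : Set} m (F : A → Fin m → ℕ) xs →
           sum (L.map (λ x → ΣFin m (F x)) xs) ≡ ΣFin m (λ i → sum (L.map (λ x → F x i) xs))
sum-ΣFin zero    F xs = sum-zero (λ _ → 0) xs (λ _ _ → refl)
sum-ΣFin (suc m) F xs = trans (sum-map-+ (λ x → F x F.zero) (λ x → ΣFin m (F x ∘ F.suc)) xs)
                              (cong (sum (L.map (λ x → F x F.zero) xs) +_) (sum-ΣFin m (λ x → F x ∘ F.suc) xs))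

sum-map-*ʳ : ∀ {A : Set} (f : A → ℕ) c xs → sum (L.map (λ x → f x * c) xs) ≡ sum (L.map f xs) * c
sum-map-*ʳ f c xs = begin
  sum (L.map (λ x → f x * c) xs) ≡⟨ cong sum (LP.map-cong (λ x → *-comm (f x) c) xs) ⟩
  sum (L.map (λ x → c * f x) xs) ≡⟨ sum-map-* c f xs ⟩
  c * sum (L.map f xs)           ≡⟨ *-comm c _ ⟩
  sum (L.map f xs) * c           ∎
  where open ≡-Reasoning

module HStar {n} {S : Formula (suc n)} (closed : ClosedUnderDirRef S) (unique : UniqueCoarsest S) where
  open Decomposition {S = S} closed unique

  compatibleMinimals : (Fin (suc n) → ℕ) → ℕ
  compatibleMinimals a = sum (L.map (λ Θ → indicator (compatible? Θ a)) minimals)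

  -- Each point lies in the cone of exactly the minimal solution below its own pattern Δ(a),
  -- and in no cone at all when S fails at a.
  holds≡compatibleMinimals : ∀ a → (if eval S a then 1 else 0) ≡ compatibleMinimals a
  holds≡compatibleMinimals a with eval S a in Sa
  ... | true  = sym (trans (sum-single (λ Θ → indicator (compatible? Θ a)) minimals-unique c∈ others)
                           (indicator-yes (compatible? c a) (⊑⇒compatible Δ-hasPattern (⪯⇒⊑ (coarsest⪯ Δ-isOSP sΔ)))))
    where
    open PatternOf a
    sΔ : Solves S Δ
    sΔ = holds⇒solves S {Δ} Δ-hasPattern (subst T (sym Sa) tt)
    c : OSP (suc n)
    c = coarsest Δ-isOSP sΔ
    c∈ : c ∈ minimals
    c∈ = coarsest-∈-minimals Δ-isOSP sΔ
    others : ∀ Θ → Θ ∈ minimals → Θ ≢ c → indicator (compatible? Θ a) ≡ 0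
    others Θ Θ∈ Θ≢c = indicator-no (compatible? Θ a) λ compat → Θ≢c (∈-minimals-⪯⇒≡coarsest Δ-isOSP sΔ Θ∈
      (⊑⇒⪯ (proj₁ (∈-minimals⇒minimal Θ∈)) Δ-isOSP (compatible⇒⊑ Δ-hasPattern compat)))
  ... | false = sym (sum-zero _ minimals λ Θ Θ∈ → indicator-no (compatible? Θ a) λ compat →
      let (oΘ , sΘ , _) = ∈-minimals⇒minimal Θ∈
          sΔ = closed Θ Δ oΘ sΘ (⊑⇒⪯ oΘ Δ-isOSP (compatible⇒⊑ Δ-hasPattern compat))
      in subst T Sa (sΔ a Δ-hasPattern))
    where open PatternOf a

  h : Fin (suc (suc n)) → ℕ
  h i = sum (L.map (λ Θ → indicator (len Θ ≟ toℕ i)) minimals)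

  len≤ : ∀ {Θ} → Θ ∈ minimals → len Θ ≤ suc n
  len≤ {Θ} Θ∈ = ⪯⇒len≤ (⊑⇒⪯ (proj₁ (∈-minimals⇒minimal Θ∈)) finest-isOSP ⊑-finest)
    where open Finest Θ

  hStarVector : HStarVector S h
  hStarVector k _ = begin
    χ S k
      ≡⟨ countPts≡boxSum (suc n) k (eval S) ⟩
    boxSum (suc n) k (λ a → if eval S a then 1 else 0)
      ≡⟨ boxSum-cong (suc n) k (λ a _ → holds≡compatibleMinimals a) ⟩
    boxSum (suc n) k compatibleMinimals
      ≡⟨ boxSum-sum (suc n) k (λ Θ → indicator ∘ compatible? Θ) minimals ⟩
    sum (L.map (λ Θ → boxSum (suc n) k (indicator ∘ compatible? Θ)) minimals)
      ≡⟨ cong sum (map-cong-∈ minimals λ Θ Θ∈ → boxSum-compatible Θ (proj₁ (∈-minimals⇒minimal Θ∈)) k) ⟩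
    sum (L.map (λ Θ → G (len Θ)) minimals)
      ≡⟨ cong sum (map-cong-∈ minimals λ Θ Θ∈ → sym (ΣFin-pick (suc (suc n)) G (len Θ) (s≤s (len≤ Θ∈)))) ⟩
    sum (L.map (λ Θ → ΣFin (suc (suc n)) (λ i → indicator (len Θ ≟ toℕ i) * G (toℕ i))) minimals)
      ≡⟨ sum-ΣFin (suc (suc n)) (λ Θ i → indicator (len Θ ≟ toℕ i) * G (toℕ i)) minimals ⟩
    ΣFin (suc (suc n)) (λ i → sum (L.map (λ Θ → indicator (len Θ ≟ toℕ i) * G (toℕ i)) minimals))
      ≡⟨ ΣFin-cong (suc (suc n)) (λ i → sum-map-*ʳ (λ Θ → indicator (len Θ ≟ toℕ i)) (G (toℕ i)) minimals) ⟩
    ΣFin (suc (suc n)) (λ i → h i * ((k + suc n ∸ toℕ i) C suc n)) ∎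
    where
    open ≡-Reasoning
    G : ℕ → ℕ
    G ℓ = (k + suc n ∸ ℓ) C suc n

Formula-0-empty : ¬ Formula 0
Formula-0-empty (atom () _)
Formula-0-empty (neg S)   = Formula-0-empty S
Formula-0-empty (and S _) = Formula-0-empty S
Formula-0-empty (or S _)  = Formula-0-empty S

mainTheorem9 : (n : ℕ) (S : Formula n) →
    ClosedUnderDirRef S → UniqueCoarsest S →
    Partitionable S
    × (Σ[ c ∈ (OSP n → ℕ) ] FundamentalExpansion S c)
    × (Σ[ h ∈ (Fin (suc n) → ℕ) ] HStarVector S h)
mainTheorem9 zero    S _      _      = ⊥-elim (Formula-0-empty S)
mainTheorem9 (suc n) S closed unique =
  partitionable , (minimalIndicator , fundamentalExpansion) , (h , hStarVector)
  where
  open Decomposition {S = S} closed unique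
  open HStar {S = S} closed unique
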